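{- Let $r\ge 1$ and $a_1\le a_2\le\cdots\le a_r$ be nonnegative integers, and let $f(x)=(x+a_1)\cdots(x+a_r)$. For all $n,j,k\in\mathbb{N}$, the coefficient $H_{j,n}^{f}[k]$ of $q^k$ in the polynomial $H_{j,n}^{f}(q)$ equals the number of $f$-Stirling partitions $P$ of order $(n,j)$ such that $s_P=k$.
   Context: $\mathbb{N}=\{0,1,2,\dots\}$. For a positive integer $m$ let $[m]=1+q+\cdots+q^{m-1}$, and $[0]=0$. The polynomials $H_{j,n}^{f}(q)$ ($j,n\in\mathbb{N}$) are defined by $H_{0,0}^f(q)=1$, $H_{0,n}^f(q)=H_{j,0}^f(q)=0$ for $j,n\ge 1$, and for $j,n\ge1$: $H_{j,n}^{f}(q)=H_{j-1,n-1}^{f}(q)+[j+a_1][j+a_2]\cdots[j+a_r]\,H_{j,n-1}^{f}(q)$. Let $X_n=\{m_i: 1\le m\le n,\ 1\le i\le r\}$ ($r$ labeled copies of each of $1,\dots,n$). An $f$-Stirling partition of order $(n,j)$ is a pair $P=(\pi,(S_1,\dots,S_{a_r}))$, where $\pi$ is an (unordered) collection of $j$ pairwise disjoint subsets ("blocks") of $X_n$ and $S_1,\dots,S_{a_r}$ is an ordered list of (possibly empty) subsets of $X_n$, such that the $j+a_r$ sets (blocks of $\pi$ and $S_1,\dots,S_{a_r}$) are pairwise disjoint with union $X_n$, and: (1) every block of $\pi$ is nonempty and, if $m$ is the smallest number $m$ for which some $m_i$ lies in the block, then $m_1,\dots,m_r$ all lie in that block; (2) some block of $\pi$ contains $1_1,\dots,1_r$;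 (3) for every $m_i\in X_n$, $m_i$ lies in a block of $\pi$ or in some $S_l$ with $l\le a_i$. Labels: each block of $\pi$ is labeled by the minimum number $m$ occurring in it, and $S_l$ is labeled $1-l$ ($l=1,\dots,a_r$); sets of $P$ are compared via their labels. For $m_i\in X_n$ lying in the set $A_{m_i}$ of $P$, let $s_{m_i}$ be the number of sets $A$ of $P$ whose label is strictly greater than the label of $A_{m_i}$ and strictly less than $m$. Let $s_P=\sum_{m_i\in X_n}s_{m_i}$ (with $s_P=0$ when $n=0$). -}

module Defs where

open import Function using (_∘_)
open import Data.Bool using (Bool; true; false; if_then_else_; _∧_; _∨_; not)
open import Data.Nat using (ℕ; zero; suc; _+_; _*_; _∸_; _<ᵇ_; _≡ᵇ_)
open import Data.Fin using (Fin; zero; suc; toℕ; fromℕ)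
open import Data.Maybe using (Maybe; just; nothing; maybe)
import Data.Maybe as Maybe
open import Data.Product using (_×_; _,_; proj₁; proj₂)
open import Data.Vec using (Vec; []; _∷_; lookup; toList; allFin)
import Data.Vec as Vec
open import Data.List using (List; []; _∷_; _++_; map; concatMap; length; filterᵇ)
open import Data.Bool.ListAction using (any; all)
open import Data.Nat.ListAction using (sum)
open import Data.Integer as ℤ using (ℤ; +_; -_)
open import Relation.Nullary using (does)

-- Polynomials in q with ℕ coefficients, represented by their coefficient
-- function: p k = coefficient of q^k.

Poly : Set
Poly = ℕ → ℕ

zeroP : Poly
zeroP _ = 0

oneP : Poly
oneP k = if k ≡ᵇ 0 then 1 else 0

-- [m] = 1 + q + ... + q^(m-1), [0] = 0
qint : ℕ → Poly
qint m k = if k <ᵇ m then 1 else 0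

_⊕_ : Poly → Poly → Poly
(p ⊕ p') k = p k + p' k

sumLe : (ℕ → ℕ) → ℕ → ℕ
sumLe f zero = f 0
sumLe f (suc k) = sumLe f k + f (suc k)

_⊗_ : Poly → Poly → Poly
(p ⊗ p') k = sumLe (λ t → p t * p' (k ∸ t)) k

prodP : ∀ {m} → (Fin m → Poly) → Poly
prodP {zero} _ = oneP
prodP {suc m} f = f zero ⊗ prodP (f ∘ suc)

-- H^f_{j,n}(q) for f(x) = (x+a_1)...(x+a_r), with a : Fin r → ℕ
-- (a i = a_{i+1}).  Arguments: r, a, j, n.
H : (r : ℕ) → (Fin r → ℕ) → ℕ → ℕ → Poly
H r a zero    zero    = oneP
H r a (suc j) zero    = zeroP
H r a zero    (suc n) = zeroP
H r a (suc j) (suc n) =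
  H r a j n ⊕ (prodP (λ i → qint (suc j + a i)) ⊗ H r a (suc j) n)

-- X_n = { m_i : 1 ≤ m ≤ n, 1 ≤ i ≤ r } is represented by Fin n × Fin r,
-- where (m , i) stands for the element (toℕ m + 1)_(toℕ i + 1).
-- A subset of X_n is a Vec (Vec Bool r) n (characteristic function).

Sub : ℕ → ℕ → Set
Sub n r = Vec (Vec Bool r) n

mem : ∀ {n r} → Sub n r → Fin n × Fin r → Bool
mem s (m , i) = lookup (lookup s m) i

orV : ∀ {k} → Vec Bool k → Bool
orV = Vec.foldr _ _∨_ false

andV : ∀ {k} → Vec Bool k → Bool
andV = Vec.foldr _ _∧_ true

elems : (n r : ℕ) → List (Fin n × Fin r)
elems n r = concatMap (λ m → map (λ i → m , i) (toList (allFin r))) (toList (allFin n))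

firstRow : ∀ {n r} → Sub n r → Maybe (Fin n)
firstRow [] = nothing
firstRow (row ∷ rows) = if orV row then just zero else Maybe.map suc (firstRow rows)

-- the minimum number m (1-based) occurring in the set (0 if empty)
minNum : ∀ {n r} → Sub n r → ℕ
minNum s = maybe (λ m → suc (toℕ m)) 0 (firstRow s)

-- a_r (the last a); only used when r ≥ 1
aLast : (r : ℕ) → (Fin r → ℕ) → ℕ
aLast zero _ = 0
aLast (suc r) a = a (fromℕ r)

-- A candidate pair (π , (S_1,...,S_{a_r})).  The unordered collection π of
-- j blocks is represented by the vector of its blocks listed in strictly
-- increasing order of their labels (this is a canonical representative;
-- see `increasing` below).
Cand : (n r j s : ℕ) → Set
Cand n r j s = Vec (Sub n r) j × Vec (Sub n r) s

-- labels of the sets of P: block ↦ its minimum number m,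
-- S_l (l = p+1, p the 0-based position) ↦ 1 - l = - p.
labelled : ∀ {n r j s} → Cand n r j s → List (ℤ × Sub n r)
labelled {s = s} (π , S) =
  map (λ b → (+ minNum b) , b) (toList π)
  ++ map (λ p → (- (+ toℕ p)) , lookup S p) (toList (allFin s))

count : ∀ {A : Set} → (A → Bool) → List A → ℕ
count p xs = length (filterᵇ p xs)

disjointCover : ∀ {n r j s} → Cand n r j s → Bool
disjointCover {n} {r} P =
  all (λ x → count (λ A → mem (proj₂ A) x) (labelled P) ≡ᵇ 1) (elems n r)

cond1 : ∀ {n r j s} → Cand n r j s → Bool
cond1 (π , S) = all (λ b → maybe (λ m → andV (lookup b m)) false (firstRow b)) (toList π)

-- (2) some block contains 1_1, ..., 1_r  (vacuous when n = 0, X_0 = ∅)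
cond2 : ∀ {n r j s} → Cand n r j s → Bool
cond2 {zero} _ = true
cond2 {suc n} (π , S) = any (λ b → andV (lookup b zero)) (toList π)

cond3 : ∀ {n r j s} → (Fin r → ℕ) → Cand n r j s → Bool
cond3 {n} {r} {s = s} a (π , S) =
  all (λ x → any (λ b → mem b x) (toList π)
           ∨ any (λ p → mem (lookup S p) x ∧ (suc (toℕ p) <ᵇ suc (a (proj₂ x))))
                 (toList (allFin s)))
      (elems n r)

increasing : ∀ {n r j} → Vec (Sub n r) j → Bool
increasing [] = true
increasing (b ∷ []) = true
increasing (b ∷ b' ∷ bs) = (minNum b <ᵇ minNum b') ∧ increasing (b' ∷ bs)

isFStirling : ∀ {n r j s} → (Fin r → ℕ) → Cand n r j s → Bool
isFStirling a P = disjointCover P ∧ cond1 P ∧ cond2 P ∧ cond3 a P ∧ increasing (proj₁ P)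

_<ℤᵇ_ : ℤ → ℤ → Bool
x <ℤᵇ y = does (x ℤ.<? y)

labelOf : ∀ {n r} → List (ℤ × Sub n r) → Fin n × Fin r → ℤ
labelOf [] x = + 0
labelOf ((l , A) ∷ As) x = if mem A x then l else labelOf As x

sP : ∀ {n r j s} → Cand n r j s → ℕ
sP {n} {r} P =
  sum (map (λ x → count (λ A → (labelOf L x <ℤᵇ proj₁ A)
                               ∧ (proj₁ A <ℤᵇ (+ suc (toℕ (proj₁ x)))))
                         L)
           (elems n r))
  where L = labelled P

vecsOf : ∀ {A : Set} → List A → (k : ℕ) → List (Vec A k)
vecsOf xs zero = [] ∷ []
vecsOf xs (suc k) = concatMap (λ x → map (x ∷_) (vecsOf xs k)) xs

allSubs : (n r : ℕ) → List (Sub n r)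
allSubs n r = vecsOf (vecsOf (true ∷ false ∷ []) r) n

allCands : (n r j s : ℕ) → List (Cand n r j s)
allCands n r j s =
  concatMap (λ π → map (λ S → π , S) (vecsOf (allSubs n r) s)) (vecsOf (allSubs n r) j)

stirlingCount : (r : ℕ) → (Fin r → ℕ) → (n j k : ℕ) → ℕ
stirlingCount r a n j k =
  count (λ P → isFStirling a P ∧ (sP P ≡ᵇ k)) (allCands n r j (aLast r a))

-- The polynomials H are determined by H_{j+1,n+1} = H_{j,n} + ∏ᵢ [j+1+aᵢ] · H_{j+1,n} and the
-- boundary values, so it suffices to show that the numbers of f-Stirling partitions obey the
-- same recurrence.  Take a partition of order (n+1, j+1).  Either the copies (n+1)₁, …, (n+1)ᵣ
-- form a block of their own; since its label n + 1 is the largest, removing it gives a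
-- partition of order (n, j) with the same s_P.  Or removing them leaves all j + 1 blocks
-- nonempty, hence a partition of order (n, j+1) with unchanged labels, and each copy (n+1)ᵢ
-- lies in one of the j + 1 blocks or in some S_l with l ≤ aᵢ (these exist because aᵢ ≤ a_r).
-- Its summand s_{(n+1)ᵢ} then takes each value 0, …, j + aᵢ exactly once over these
-- placements, and the r copies are placed independently, which produces ∏ᵢ [j+1+aᵢ].
-- Sets are encoded by incidence vectors, so both counts become sums over all Boolean
-- vectors, and the argument splits off the last row of every set.

module Submission where

open import Function using (_∘_)
open import Data.Bool using (Bool; true; false; if_then_else_; _∧_; _∨_; not; T)
open import Data.Bool.Properties using (∧-assoc; ∧-identityʳ; ∧-zeroʳ; ∨-identityʳ; ∨-zeroʳ)
open import Data.Nat using (ℕ; zero; suc; _+_; _*_; _∸_; _<ᵇ_; _≡ᵇ_; _≤_; z≤n; s≤s)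
open import Data.Nat.Properties
open import Algebra.Properties.CommutativeSemigroup +-commutativeSemigroup using (interchange)
open import Data.Fin using (Fin; zero; suc; toℕ; fromℕ; inject₁)
import Data.Fin as Fin
open import Data.Fin.Properties using (toℕ-inject₁; toℕ-fromℕ; ≤fromℕ)
open import Data.Maybe using (Maybe; just; nothing; maybe)
open import Data.Product using (_×_; _,_; proj₁; proj₂)
open import Data.List using (List; []; _∷_; _++_; map; concatMap; length)
import Data.List.Properties as LP
open import Data.Vec using (Vec; []; _∷_; _∷ʳ_; lookup; toList; allFin; tabulate; zipWith; replicate)
import Data.Vec as Vec
import Data.Vec.Properties as VP
open import Data.Bool.ListAction using (any; all)
open import Data.Nat.ListAction using (sum)
open import Data.Integer as ℤ using (ℤ; +_; -_)
open import Data.Empty using (⊥; ⊥-elim)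
open import Relation.Binary.PropositionalEquality hiding (J)
open import Defs

ΣL : {A : Set} → List A → (A → ℕ) → ℕ
ΣL [] f = 0
ΣL (x ∷ xs) f = f x + ΣL xs f

⟦_⟧ : Bool → ℕ
⟦ b ⟧ = if b then 1 else 0

⟦∧⟧ : ∀ b c → ⟦ b ∧ c ⟧ ≡ ⟦ b ⟧ * ⟦ c ⟧
⟦∧⟧ true c = sym (+-identityʳ _)
⟦∧⟧ false c = refl

count≡ΣL : ∀ {A : Set} (p : A → Bool) xs → count p xs ≡ ΣL xs (λ x → ⟦ p x ⟧)
count≡ΣL p [] = refl
count≡ΣL p (x ∷ xs) with p x
... | true = cong suc (count≡ΣL p xs)
... | false = count≡ΣL p xs

ΣL-cong : ∀ {A : Set} (xs : List A) {f g : A → ℕ} → (∀ x → f x ≡ g x) → ΣL xs f ≡ ΣL xs g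
ΣL-cong [] e = refl
ΣL-cong (x ∷ xs) e = cong₂ _+_ (e x) (ΣL-cong xs e)

ΣL-++ : ∀ {A : Set} (xs ys : List A) (f : A → ℕ) → ΣL (xs ++ ys) f ≡ ΣL xs f + ΣL ys f
ΣL-++ [] ys f = refl
ΣL-++ (x ∷ xs) ys f = trans (cong (_+_ (f x)) (ΣL-++ xs ys f)) (sym (+-assoc (f x) _ _))

ΣL-map : ∀ {A B : Set} (h : A → B) (xs : List A) (f : B → ℕ) → ΣL (map h xs) f ≡ ΣL xs (f ∘ h)
ΣL-map h [] f = refl
ΣL-map h (x ∷ xs) f = cong (_+_ (f (h x))) (ΣL-map h xs f)

ΣL-concatMap : ∀ {A B : Set} (g : A → List B) (xs : List A) (f : B → ℕ) →
  ΣL (concatMap g xs) f ≡ ΣL xs (λ x → ΣL (g x) f)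
ΣL-concatMap g [] f = refl
ΣL-concatMap g (x ∷ xs) f = trans (ΣL-++ (g x) (concatMap g xs) f) (cong (_+_ (ΣL (g x) f)) (ΣL-concatMap g xs f))

ΣL-+ : ∀ {A : Set} (xs : List A) (f g : A → ℕ) → ΣL xs (λ x → f x + g x) ≡ ΣL xs f + ΣL xs g
ΣL-+ [] f g = refl
ΣL-+ (x ∷ xs) f g rewrite ΣL-+ xs f g = interchange (f x) (g x) (ΣL xs f) (ΣL xs g)

ΣL-zero : ∀ {A : Set} (xs : List A) → ΣL xs (λ _ → 0) ≡ 0
ΣL-zero [] = refl
ΣL-zero (x ∷ xs) = ΣL-zero xs

ΣL-*ˡ : ∀ {A : Set} (xs : List A) (c : ℕ) (f : A → ℕ) → ΣL xs (λ x → c * f x) ≡ c * ΣL xs f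
ΣL-*ˡ [] c f = sym (*-zeroʳ c)
ΣL-*ˡ (x ∷ xs) c f = trans (cong (_+_ (c * f x)) (ΣL-*ˡ xs c f)) (sym (*-distribˡ-+ c (f x) _))

ΣL-*ʳ : ∀ {A : Set} (xs : List A) (c : ℕ) (f : A → ℕ) → ΣL xs (λ x → f x * c) ≡ ΣL xs f * c
ΣL-*ʳ xs c f = trans (ΣL-cong xs (λ x → *-comm (f x) c)) (trans (ΣL-*ˡ xs c f) (*-comm c _))

ΣL-swap : ∀ {A B : Set} (xs : List A) (ys : List B) (f : A → B → ℕ) →
  ΣL xs (λ x → ΣL ys (f x)) ≡ ΣL ys (λ y → ΣL xs (λ x → f x y))
ΣL-swap [] ys f = sym (ΣL-zero ys)
ΣL-swap (x ∷ xs) ys f = trans (cong (_+_ (ΣL ys (f x))) (ΣL-swap xs ys f)) (sym (ΣL-+ ys (f x) (λ y → ΣL xs (λ x' → f x' y))))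

sum-map≡ΣL : ∀ {A : Set} (f : A → ℕ) xs → sum (map f xs) ≡ ΣL xs f
sum-map≡ΣL f [] = refl
sum-map≡ΣL f (x ∷ xs) = cong (λ z → f x + z) (sum-map≡ΣL f xs)

count-map : ∀ {A B : Set} (p : B → Bool) (f : A → B) xs → count p (map f xs) ≡ count (p ∘ f) xs
count-map p f xs = trans (count≡ΣL p (map f xs)) (trans (ΣL-map f xs _) (sym (count≡ΣL (p ∘ f) xs)))

count-++ : ∀ {A : Set} (p : A → Bool) xs ys → count p (xs ++ ys) ≡ count p xs + count p ys
count-++ p xs ys = trans (count≡ΣL p (xs ++ ys)) (trans (ΣL-++ xs ys _) (sym (cong₂ _+_ (count≡ΣL p xs) (count≡ΣL p ys))))

count-cong : ∀ {A : Set} (xs : List A) {p q : A → Bool} → (∀ x → p x ≡ q x) → count p xs ≡ count q xs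
count-cong xs {p} {q} e = trans (count≡ΣL p xs) (trans (ΣL-cong xs (λ x → cong ⟦_⟧ (e x))) (sym (count≡ΣL q xs)))

count-∷-true : ∀ {A : Set} (p : A → Bool) x xs → p x ≡ true → count p (x ∷ xs) ≡ suc (count p xs)
count-∷-true p x xs e rewrite count≡ΣL p (x ∷ xs) | count≡ΣL p xs | e = refl

count-∷-false : ∀ {A : Set} (p : A → Bool) x xs → p x ≡ false → count p (x ∷ xs) ≡ count p xs
count-∷-false p x xs e rewrite count≡ΣL p (x ∷ xs) | count≡ΣL p xs | e = refl

count-insert : ∀ {A : Set} (p : A → Bool) (xs : List A) y zs → count p (xs ++ y ∷ zs) ≡ ⟦ p y ⟧ + count p (xs ++ zs)
count-insert p xs y zs rewrite count≡ΣL p (xs ++ y ∷ zs) | count≡ΣL p (xs ++ zs) | ΣL-++ xs (y ∷ zs) (λ x → ⟦ p x ⟧) | ΣL-++ xs zs (λ x → ⟦ p x ⟧) =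
  trans (sym (+-assoc (ΣL xs _) ⟦ p y ⟧ _)) (trans (cong (_+ ΣL zs (λ x → ⟦ p x ⟧)) (+-comm (ΣL xs _) ⟦ p y ⟧)) (+-assoc ⟦ p y ⟧ _ _))

count-none : ∀ {A : Set} (p : A → Bool) xs → (∀ x → p x ≡ false) → count p xs ≡ 0
count-none p [] h = refl
count-none p (x ∷ xs) h rewrite h x = count-none p xs h

∧-true-l : ∀ {a b} → a ∧ b ≡ true → a ≡ true
∧-true-l {true} e = refl

∧-true-r : ∀ {a b} → a ∧ b ≡ true → b ≡ true
∧-true-r {true} e = e

ΣL-cong-all : ∀ {A : Set} (xs : List A) (p : A → Bool) (f g : A → ℕ) → all p xs ≡ true → (∀ x → p x ≡ true → f x ≡ g x) → ΣL xs f ≡ ΣL xs g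
ΣL-cong-all [] p f g e h = refl
ΣL-cong-all (x ∷ xs) p f g e h = cong₂ _+_ (h x (∧-true-l {p x} {all p xs} e)) (ΣL-cong-all xs p f g (∧-true-r {p x} e) h)

ΣL-+-cong : ∀ {A : Set} (xs : List A) {f g h : A → ℕ} → (∀ x → f x ≡ g x + h x) → ΣL xs f ≡ ΣL xs g + ΣL xs h
ΣL-+-cong xs {f} {g} {h} e = trans (ΣL-cong xs e) (ΣL-+ xs g h)

ΣL-unique : ∀ {A : Set} (xs : List A) (p : A → Bool) c → ΣL xs (λ x → ⟦ p x ⟧) ≡ 1 → ΣL xs (λ x → ⟦ p x ⟧ * c) ≡ c
ΣL-unique xs p c h = trans (ΣL-*ʳ xs c (λ x → ⟦ p x ⟧)) (trans (cong (_* c) h) (+-identityʳ c))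

ΣL⁴-separate : ∀ {A B C D : Set} (xs : List A) (ys : List B) (zs : List C) (ws : List D) (F : A → C → ℕ) (G : B → D → ℕ) →
  ΣL xs (λ u → ΣL ys (λ c → ΣL zs (λ v → ΣL ws (λ d → F u v * G c d)))) ≡
  ΣL xs (λ u → ΣL zs (λ v → F u v)) * ΣL ys (λ c → ΣL ws (λ d → G c d))
ΣL⁴-separate xs ys zs ws F G =
  trans (ΣL-cong xs (λ u → ΣL-cong ys (λ c → trans (ΣL-cong zs (λ v → ΣL-*ˡ ws (F u v) (G c))) (ΣL-*ʳ zs (ΣL ws (G c)) (F u)))))
  (trans (ΣL-cong xs (λ u → ΣL-*ˡ ys (ΣL zs (F u)) (λ c → ΣL ws (G c))))
  (ΣL-*ʳ xs (ΣL ys (λ c → ΣL ws (G c))) (λ u → ΣL zs (F u))))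

⟦≡ᵇ⟧+⟦<ᵇ⟧ : ∀ J x → ⟦ J ≡ᵇ x ⟧ + ⟦ x <ᵇ J ⟧ ≡ ⟦ x <ᵇ suc J ⟧
⟦≡ᵇ⟧+⟦<ᵇ⟧ zero zero = refl
⟦≡ᵇ⟧+⟦<ᵇ⟧ zero (suc x) = refl
⟦≡ᵇ⟧+⟦<ᵇ⟧ (suc J) zero = refl
⟦≡ᵇ⟧+⟦<ᵇ⟧ (suc J) (suc x) = ⟦≡ᵇ⟧+⟦<ᵇ⟧ J x

≡ᵇ-sym : ∀ x z → (x ≡ᵇ z) ≡ (z ≡ᵇ x)
≡ᵇ-sym zero zero = refl
≡ᵇ-sym zero (suc z) = refl
≡ᵇ-sym (suc x) zero = refl
≡ᵇ-sym (suc x) (suc z) = ≡ᵇ-sym x z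

sumLe-⟦≡ᵇ⟧ : ∀ x t → sumLe (λ z → ⟦ x ≡ᵇ z ⟧) t ≡ ⟦ x <ᵇ suc t ⟧
sumLe-⟦≡ᵇ⟧ zero zero = refl
sumLe-⟦≡ᵇ⟧ (suc x) zero = refl
sumLe-⟦≡ᵇ⟧ x (suc t) = trans (cong₂ _+_ (sumLe-⟦≡ᵇ⟧ x t) (cong ⟦_⟧ (≡ᵇ-sym x (suc t)))) (trans (+-comm ⟦ x <ᵇ suc t ⟧ ⟦ suc t ≡ᵇ x ⟧) (⟦≡ᵇ⟧+⟦<ᵇ⟧ (suc t) x))

⟦≡ᵇ⟧*-subst : ∀ x z (F : ℕ → ℕ) → ⟦ x ≡ᵇ z ⟧ * F z ≡ ⟦ x ≡ᵇ z ⟧ * F x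
⟦≡ᵇ⟧*-subst zero zero F = refl
⟦≡ᵇ⟧*-subst zero (suc z) F = refl
⟦≡ᵇ⟧*-subst (suc x) zero F = refl
⟦≡ᵇ⟧*-subst (suc x) (suc z) F = ⟦≡ᵇ⟧*-subst x z (F ∘ suc)

sumLe-cong : ∀ t {f g : ℕ → ℕ} → (∀ z → f z ≡ g z) → sumLe f t ≡ sumLe g t
sumLe-cong zero e = e 0
sumLe-cong (suc t) e = cong₂ _+_ (sumLe-cong t e) (e (suc t))

sumLe-zero : ∀ t → sumLe (λ _ → 0) t ≡ 0
sumLe-zero zero = refl
sumLe-zero (suc t) = cong (_+ 0) (sumLe-zero t)

sumLe-*ʳ : ∀ t (f : ℕ → ℕ) c → sumLe (λ z → f z * c) t ≡ sumLe f t * c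
sumLe-*ʳ zero f c = refl
sumLe-*ʳ (suc t) f c = trans (cong (_+ f (suc t) * c) (sumLe-*ʳ t f c)) (sym (*-distribʳ-+ c (sumLe f t) (f (suc t))))

ΣL-sumLe : ∀ {A : Set} (xs : List A) t (f : A → ℕ → ℕ) → ΣL xs (λ x → sumLe (f x) t) ≡ sumLe (λ z → ΣL xs (λ x → f x z)) t
ΣL-sumLe xs zero f = refl
ΣL-sumLe xs (suc t) f = trans (ΣL-+ xs (λ x → sumLe (f x) t) (λ x → f x (suc t))) (cong (_+ ΣL xs (λ x → f x (suc t))) (ΣL-sumLe xs t f))

sumLe-delta : ∀ x t (F : ℕ → ℕ) → sumLe (λ z → ⟦ x ≡ᵇ z ⟧ * F z) t ≡ ⟦ x <ᵇ suc t ⟧ * F x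
sumLe-delta x t F = trans (sumLe-cong t (λ z → ⟦≡ᵇ⟧*-subst x z F)) (trans (sumLe-*ʳ t (λ z → ⟦ x ≡ᵇ z ⟧) (F x)) (cong (_* F x) (sumLe-⟦≡ᵇ⟧ x t)))

⟦+≡ᵇ⟧ : ∀ x y t → ⟦ x + y ≡ᵇ t ⟧ ≡ ⟦ x <ᵇ suc t ⟧ * ⟦ y ≡ᵇ t ∸ x ⟧
⟦+≡ᵇ⟧ zero y t = sym (+-identityʳ _)
⟦+≡ᵇ⟧ (suc x) y zero = refl
⟦+≡ᵇ⟧ (suc x) y (suc t) = ⟦+≡ᵇ⟧ x y t

⟦+≡ᵇ⟧-sumLe : ∀ b1 b2 x y t → ⟦ (b1 ∧ b2) ∧ (x + y ≡ᵇ t) ⟧ ≡ sumLe (λ z → ⟦ b1 ∧ (x ≡ᵇ z) ⟧ * ⟦ b2 ∧ (y ≡ᵇ t ∸ z) ⟧) t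
⟦+≡ᵇ⟧-sumLe false b2 x y t = sym (sumLe-zero t)
⟦+≡ᵇ⟧-sumLe true false x y t = sym (trans (sumLe-cong t (λ z → *-zeroʳ ⟦ x ≡ᵇ z ⟧)) (sumLe-zero t))
⟦+≡ᵇ⟧-sumLe true true x y t = trans (⟦+≡ᵇ⟧ x y t) (sym (sumLe-delta x t (λ z → ⟦ y ≡ᵇ t ∸ z ⟧)))

⟦∧+≡ᵇ⟧ : ∀ g x y k → ⟦ g ∧ (x + y ≡ᵇ k) ⟧ ≡ ⟦ x <ᵇ suc k ⟧ * ⟦ g ∧ (y ≡ᵇ k ∸ x) ⟧
⟦∧+≡ᵇ⟧ false x y k = sym (*-zeroʳ ⟦ x <ᵇ suc k ⟧)
⟦∧+≡ᵇ⟧ true x y k = ⟦+≡ᵇ⟧ x y k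

sumLe-shift : ∀ k (f : ℕ → ℕ) → sumLe f (suc k) ≡ f 0 + sumLe (f ∘ suc) k
sumLe-shift zero f = refl
sumLe-shift (suc k) f = trans (cong (_+ f (suc (suc k))) (sumLe-shift k f)) (+-assoc (f 0) _ _)

sumLe-rev : ∀ k (f : ℕ → ℕ) → sumLe f k ≡ sumLe (λ t → f (k ∸ t)) k
sumLe-rev zero f = refl
sumLe-rev (suc k) f = sym (trans (sumLe-shift k (λ t → f (suc k ∸ t)))
  (trans (cong (_+_ (f (suc k))) (sym (sumLe-rev k f))) (+-comm (f (suc k)) (sumLe f k))))

sumLe-cong≤ : ∀ t {f g : ℕ → ℕ} → (∀ z → z ≤ t → f z ≡ g z) → sumLe f t ≡ sumLe g t
sumLe-cong≤ zero e = e 0 z≤n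
sumLe-cong≤ (suc t) e = cong₂ _+_ (sumLe-cong≤ t (λ z le → e z (m≤n⇒m≤1+n le))) (e (suc t) ≤-refl)

sumLe-convolution-comm : ∀ k (f g : ℕ → ℕ) → sumLe (λ t → f t * g (k ∸ t)) k ≡ sumLe (λ t → g t * f (k ∸ t)) k
sumLe-convolution-comm k f g = trans (sumLe-rev k (λ t → f t * g (k ∸ t)))
  (sumLe-cong≤ k (λ z le → trans (cong (f (k ∸ z) *_) (cong g (m∸[m∸n]≡n le))) (*-comm (f (k ∸ z)) (g z))))

sumLe-*ˡ : ∀ t c (f : ℕ → ℕ) → sumLe (λ z → c * f z) t ≡ c * sumLe f t
sumLe-*ˡ t c f = trans (sumLe-cong t (λ z → *-comm c (f z))) (trans (sumLe-*ʳ t f c) (*-comm (sumLe f t) c))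

⟦∧⟧-rearrange : ∀ A B C D I → ⟦ A ∧ B ∧ C ∧ D ⟧ * I ≡ ⟦ B ⟧ * (⟦ C ⟧ * (⟦ A ⟧ * (⟦ D ⟧ * I)))
⟦∧⟧-rearrange true true true true I = trans (*-identityˡ I) (sym (trans (*-identityˡ _) (trans (*-identityˡ _) (trans (*-identityˡ _) (*-identityˡ I)))))
⟦∧⟧-rearrange true true true false I = refl
⟦∧⟧-rearrange true true false D I = refl
⟦∧⟧-rearrange true false C D I = refl
⟦∧⟧-rearrange false true true D I = refl
⟦∧⟧-rearrange false true false D I = refl
⟦∧⟧-rearrange false false C D I = refl

sum< : ℕ → (ℕ → ℕ) → ℕ
sum< zero G = 0
sum< (suc m) G = G 0 + sum< m (G ∘ suc)

sum<-cong : ∀ m {G G' : ℕ → ℕ} → (∀ q → G q ≡ G' q) → sum< m G ≡ sum< m G'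
sum<-cong zero e = refl
sum<-cong (suc m) e = cong₂ _+_ (e 0) (sum<-cong m (λ q → e (suc q)))

sum<-zero : ∀ m → sum< m (λ _ → 0) ≡ 0
sum<-zero zero = refl
sum<-zero (suc m) = sum<-zero m

ΣL-vecsOf-∷ : ∀ {A : Set} (xs : List A) k (g : Vec A (suc k) → ℕ) →
  ΣL (vecsOf xs (suc k)) g ≡ ΣL xs (λ x → ΣL (vecsOf xs k) (λ v → g (x ∷ v)))
ΣL-vecsOf-∷ xs k g = trans (ΣL-concatMap _ xs g) (ΣL-cong xs (λ x → ΣL-map (x ∷_) (vecsOf xs k) g))

ΣL-vecsOf-∷ʳ : ∀ {A : Set} (xs : List A) k (g : Vec A (suc k) → ℕ) →
  ΣL (vecsOf xs (suc k)) g ≡ ΣL (vecsOf xs k) (λ v → ΣL xs (λ x → g (v ∷ʳ x)))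
ΣL-vecsOf-∷ʳ xs zero g = trans (ΣL-vecsOf-∷ xs 0 g) (trans (ΣL-cong xs (λ x → +-identityʳ _)) (sym (+-identityʳ _)))
ΣL-vecsOf-∷ʳ xs (suc k) g =
  trans (ΣL-vecsOf-∷ xs (suc k) g)
  (trans (ΣL-cong xs (λ x → ΣL-vecsOf-∷ʳ xs k (λ v → g (x ∷ v))))
  (trans (ΣL-cong xs (λ x → ΣL-swap (vecsOf xs k) xs (λ v y → g (x ∷ (v ∷ʳ y)))))
  (trans (ΣL-swap xs xs _)
  (trans (ΣL-cong xs (λ y → sym (ΣL-vecsOf-∷ xs k (λ w → g (w ∷ʳ y)))))
  (sym (ΣL-swap (vecsOf xs (suc k)) xs (λ w y → g (w ∷ʳ y))))))))

ΣL-vecsOf-zipWith : ∀ {A B C : Set} (xsA : List A) (xsB : List B) (xsC : List C) (comb : A → B → C) →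
  (∀ (h : C → ℕ) → ΣL xsC h ≡ ΣL xsA (λ a → ΣL xsB (λ b → h (comb a b)))) →
  ∀ m (g : Vec C m → ℕ) →
  ΣL (vecsOf xsC m) g ≡ ΣL (vecsOf xsA m) (λ va → ΣL (vecsOf xsB m) (λ vb → g (zipWith comb va vb)))
ΣL-vecsOf-zipWith xsA xsB xsC comb H zero g = sym (+-identityʳ _)
ΣL-vecsOf-zipWith xsA xsB xsC comb H (suc m) g =
  trans (ΣL-vecsOf-∷ xsC m g)
  (trans (ΣL-cong xsC (λ c → ΣL-vecsOf-zipWith xsA xsB xsC comb H m (λ v → g (c ∷ v))))
  (trans (H _)
  (trans (ΣL-cong xsA (λ a → ΣL-swap xsB (vecsOf xsA m) _))
  (trans (ΣL-cong xsA (λ a → ΣL-cong (vecsOf xsA m) (λ va → sym (ΣL-vecsOf-∷ xsB m (λ w → g (zipWith comb (a ∷ va) w))))))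
  (sym (ΣL-vecsOf-∷ xsA m _))))))

ΣL-vecsOf-singleton : ∀ {A : Set} (x : A) m (g : Vec A m → ℕ) → ΣL (vecsOf (x ∷ []) m) g ≡ g (replicate m x)
ΣL-vecsOf-singleton x zero g = +-identityʳ _
ΣL-vecsOf-singleton x (suc m) g = trans (ΣL-vecsOf-∷ (x ∷ []) m g) (trans (+-identityʳ _) (ΣL-vecsOf-singleton x m (λ v → g (x ∷ v))))

bools : List Bool
bools = true ∷ false ∷ []

allV : ∀ {A : Set} {m} → (A → Bool) → Vec A m → Bool
allV p [] = true
allV p (x ∷ xs) = p x ∧ allV p xs

ΣL-allV-unique : ∀ {A : Set} (xs : List A) (p : A → Bool) → ΣL xs (λ x → ⟦ p x ⟧) ≡ 1 → ∀ m → ΣL (vecsOf xs m) (λ v → ⟦ allV p v ⟧) ≡ 1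
ΣL-allV-unique xs p h zero = refl
ΣL-allV-unique xs p h (suc m) = trans (ΣL-vecsOf-∷ xs m _)
  (trans (ΣL-cong xs (λ x → trans (ΣL-cong (vecsOf xs m) (λ v → ⟦∧⟧ (p x) (allV p v)))
                              (trans (ΣL-*ˡ (vecsOf xs m) ⟦ p x ⟧ (λ v → ⟦ allV p v ⟧))
                                     (trans (cong (⟦ p x ⟧ *_) (ΣL-allV-unique xs p h m)) (*-identityʳ _)))))
  h)

unique-allFalseRow : ∀ r → ΣL (vecsOf bools r) (λ v → ⟦ allV not v ⟧) ≡ 1
unique-allFalseRow r = ΣL-allV-unique bools not refl r

unique-allTrueRow : ∀ r → ΣL (vecsOf bools r) (λ v → ⟦ allV (λ b → b) v ⟧) ≡ 1
unique-allTrueRow r = ΣL-allV-unique bools (λ b → b) refl r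

unique-emptySub : ∀ r n → ΣL (vecsOf (vecsOf bools r) n) (λ v → ⟦ allV (allV not) v ⟧) ≡ 1
unique-emptySub r n = ΣL-allV-unique (vecsOf bools r) (allV not) (unique-allFalseRow r) n

transpose : ∀ {J r} → Vec (Vec Bool J) r → Vec (Vec Bool r) J
transpose {J} [] = replicate J []
transpose (c ∷ C) = zipWith _∷_ c (transpose C)

ΣL-transpose : ∀ J r (g : Vec (Vec Bool r) J → ℕ) → ΣL (vecsOf (vecsOf bools r) J) g ≡ ΣL (vecsOf (vecsOf bools J) r) (g ∘ transpose)
ΣL-transpose J zero g = trans (ΣL-vecsOf-singleton [] J g) (sym (+-identityʳ _))
ΣL-transpose J (suc r) g =
  trans (ΣL-vecsOf-zipWith bools (vecsOf bools r) (vecsOf bools (suc r)) _∷_ (ΣL-vecsOf-∷ bools r) J g)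
  (trans (ΣL-cong (vecsOf bools J) (λ c → ΣL-transpose J r (λ R → g (zipWith _∷_ c R))))
  (sym (ΣL-vecsOf-∷ (vecsOf bools J) r (g ∘ transpose))))

column : ∀ {r m} → Vec (Vec Bool r) m → Fin r → Vec Bool m
column R i = Vec.map (λ row → lookup row i) R

column-zipWith-zero : ∀ {r m} (c : Vec Bool m) (R : Vec (Vec Bool r) m) → column (zipWith _∷_ c R) zero ≡ c
column-zipWith-zero [] [] = refl
column-zipWith-zero (x ∷ c) (_ ∷ R) = cong (x ∷_) (column-zipWith-zero c R)

column-zipWith-suc : ∀ {r m} (c : Vec Bool m) (R : Vec (Vec Bool r) m) i → column (zipWith _∷_ c R) (suc i) ≡ column R i
column-zipWith-suc [] [] i = refl
column-zipWith-suc (x ∷ c) (row ∷ R) i = cong (lookup row i ∷_) (column-zipWith-suc c R i)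

column-transpose : ∀ {J r} (C : Vec (Vec Bool J) r) i → column (transpose C) i ≡ lookup C i
column-transpose (c ∷ C) zero = column-zipWith-zero c (transpose C)
column-transpose (c ∷ C) (suc i) = trans (column-zipWith-suc c (transpose C) i) (column-transpose C i)

allV-not⇒orV : ∀ {m} (row : Vec Bool m) → allV not row ≡ true → orV row ≡ false
allV-not⇒orV [] e = refl
allV-not⇒orV (false ∷ row) e = allV-not⇒orV row e

#true : ∀ {m} → Vec Bool m → ℕ
#true [] = 0
#true (b ∷ v) = ⟦ b ⟧ + #true v

firstTrue : ∀ {m} → Vec Bool m → ℕ
firstTrue [] = 0
firstTrue (true ∷ v) = 0
firstTrue (false ∷ v) = suc (firstTrue v)

anyTrueWith : ∀ {s} → (ℕ → Bool) → Vec Bool s → Bool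
anyTrueWith {s} H v = any (λ p → lookup v p ∧ H (toℕ p)) (toList (allFin s))

map-tabulate : ∀ {A B : Set} {m} (f : A → B) (g : Fin m → A) → map f (toList (tabulate g)) ≡ toList (tabulate (f ∘ g))
map-tabulate {m = zero} f g = refl
map-tabulate {m = suc m} f g = cong (f (g zero) ∷_) (map-tabulate f (g ∘ suc))

map-allFin-suc : ∀ {B : Set} {m} (f : Fin (suc m) → B) → map f (toList (allFin (suc m))) ≡ f zero ∷ map (f ∘ suc) (toList (allFin m))
map-allFin-suc {m = m} f = cong (f zero ∷_) (trans (map-tabulate f suc) (sym (map-tabulate (f ∘ suc) (λ i → i))))

any-allFin-suc : ∀ {m} (p : Fin (suc m) → Bool) → any p (toList (allFin (suc m))) ≡ p zero ∨ any (p ∘ suc) (toList (allFin m))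
any-allFin-suc {m} p = cong (Data.List.foldr _∨_ false) (map-allFin-suc p)

anyTrueWith-∷ : ∀ {s} H x (v : Vec Bool s) → anyTrueWith H (x ∷ v) ≡ (x ∧ H 0) ∨ anyTrueWith (H ∘ suc) v
anyTrueWith-∷ H x v = any-allFin-suc (λ p → lookup (x ∷ v) p ∧ H (toℕ p))

anyTrueWith-none : ∀ {s} H (v : Vec Bool s) → #true v ≡ 0 → anyTrueWith H v ≡ false
anyTrueWith-none H [] e = refl
anyTrueWith-none H (false ∷ v) e = trans (anyTrueWith-∷ H false v) (anyTrueWith-none (H ∘ suc) v e)

anyTrueWith-single : ∀ {s} H (v : Vec Bool s) → #true v ≡ 1 → anyTrueWith H v ≡ H (firstTrue v)
anyTrueWith-single H [] ()
anyTrueWith-single H (true ∷ v) e = trans (anyTrueWith-∷ H true v) (trans (cong (H 0 ∨_) (anyTrueWith-none (H ∘ suc) v (suc-injective e))) (∨-identityʳ (H 0)))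
anyTrueWith-single H (false ∷ v) e = trans (anyTrueWith-∷ H false v) (anyTrueWith-single (H ∘ suc) v e)

orV-none : ∀ {m} (u : Vec Bool m) → #true u ≡ 0 → orV u ≡ false
orV-none [] e = refl
orV-none (false ∷ u) e = orV-none u e

orV-some : ∀ {m} (u : Vec Bool m) {c} → #true u ≡ suc c → orV u ≡ true
orV-some [] ()
orV-some (true ∷ u) e = refl
orV-some (false ∷ u) e = orV-some u e

ΣL-#true≡0 : ∀ m → ΣL (vecsOf bools m) (λ u → ⟦ #true u ≡ᵇ 0 ⟧) ≡ 1
ΣL-#true≡0 zero = refl
ΣL-#true≡0 (suc m) = trans (ΣL-vecsOf-∷ bools m _) (trans (cong₂ _+_ (ΣL-zero (vecsOf bools m)) (cong (_+ 0) (ΣL-#true≡0 m))) refl)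

ΣL-#true≡1 : ∀ m (G : ℕ → ℕ) → ΣL (vecsOf bools m) (λ u → ⟦ #true u ≡ᵇ 1 ⟧ * G (firstTrue u)) ≡ sum< m G
ΣL-#true≡1 zero G = refl
ΣL-#true≡1 (suc m) G = trans (ΣL-vecsOf-∷ bools m _)
  (cong₂ _+_ (trans (ΣL-*ʳ (vecsOf bools m) (G 0) (λ u → ⟦ #true u ≡ᵇ 0 ⟧)) (trans (cong (_* G 0) (ΣL-#true≡0 m)) (+-identityʳ (G 0))))
             (trans (+-identityʳ _) (ΣL-#true≡1 m (G ∘ suc))))

all-allFin-suc : ∀ {m} (p : Fin (suc m) → Bool) → all p (toList (allFin (suc m))) ≡ p zero ∧ all (p ∘ suc) (toList (allFin m))
all-allFin-suc {m} p = cong (Data.List.foldr _∧_ true) (map-allFin-suc p)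

ΣL-allFin-suc : ∀ {m} (f : Fin (suc m) → ℕ) → ΣL (toList (allFin (suc m))) f ≡ f zero + ΣL (toList (allFin m)) (f ∘ suc)
ΣL-allFin-suc {m} f = trans (sym (ΣL-map f (toList (allFin (suc m))) (λ x → x)))
  (trans (cong (λ l → ΣL l (λ x → x)) (map-allFin-suc f)) (cong (_+_ (f zero)) (ΣL-map (f ∘ suc) (toList (allFin m)) (λ x → x))))

toList-tabulate-∷ʳ : ∀ {A : Set} {n} (f : Fin (suc n) → A) → toList (tabulate f) ≡ toList (tabulate (f ∘ inject₁)) ++ (f (fromℕ n) ∷ [])
toList-tabulate-∷ʳ {n = zero} f = refl
toList-tabulate-∷ʳ {n = suc n} f = cong (f zero ∷_) (toList-tabulate-∷ʳ (f ∘ suc))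

map-allFin-∷ʳ : ∀ {A : Set} {n} (f : Fin (suc n) → A) → map f (toList (allFin (suc n))) ≡ map (f ∘ inject₁) (toList (allFin n)) ++ (f (fromℕ n) ∷ [])
map-allFin-∷ʳ {n = n} f = trans (map-tabulate f (λ i → i)) (trans (toList-tabulate-∷ʳ f) (cong (_++ _) (sym (map-tabulate (f ∘ inject₁) (λ i → i)))))

all-++ : ∀ {A : Set} (p : A → Bool) xs ys → all p (xs ++ ys) ≡ all p xs ∧ all p ys
all-++ p [] ys = refl
all-++ p (x ∷ xs) ys = trans (cong (p x ∧_) (all-++ p xs ys)) (sym (∧-assoc (p x) _ _))

all-map : ∀ {A B : Set} (p : B → Bool) (f : A → B) xs → all p (map f xs) ≡ all (p ∘ f) xs
all-map p f [] = refl
all-map p f (x ∷ xs) = cong (p (f x) ∧_) (all-map p f xs)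

any-cong : ∀ {A : Set} (xs : List A) {p q : A → Bool} → (∀ x → p x ≡ q x) → any p xs ≡ any q xs
any-cong [] e = refl
any-cong (x ∷ xs) e = cong₂ _∨_ (e x) (any-cong xs e)

all-cong : ∀ {A : Set} (xs : List A) {p q : A → Bool} → (∀ x → p x ≡ q x) → all p xs ≡ all q xs
all-cong [] e = refl
all-cong (x ∷ xs) e = cong₂ _∧_ (e x) (all-cong xs e)

all-∧ : ∀ {A : Set} (xs : List A) (p q : A → Bool) → (all p xs ∧ all q xs) ≡ all (λ x → p x ∧ q x) xs
all-∧ [] p q = refl
all-∧ (x ∷ xs) p q with p x | q x
... | true | true = all-∧ xs p q
... | true | false = ∧-zeroʳ (all p xs)
... | false | _ = refl

any-++ : ∀ {A : Set} (p : A → Bool) xs ys → any p (xs ++ ys) ≡ any p xs ∨ any p ys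
any-++ p [] ys = refl
any-++ p (x ∷ xs) ys rewrite any-++ p xs ys with p x
... | true = refl
... | false = refl

all-const-true : ∀ {A : Set} (xs : List A) → all (λ _ → true) xs ≡ true
all-const-true [] = refl
all-const-true (x ∷ xs) = all-const-true xs

all-allFin⇒ : ∀ {r} (q : Fin r → Bool) → all q (toList (allFin r)) ≡ true → ∀ i → q i ≡ true
all-allFin⇒ {suc r} q h zero = ∧-true-l {q zero} {all (q ∘ suc) (toList (allFin r))} (trans (sym (all-allFin-suc q)) h)
all-allFin⇒ {suc r} q h (suc i) = all-allFin⇒ (q ∘ suc) (∧-true-r {q zero} (trans (sym (all-allFin-suc q)) h)) i

count-lookup≡#true : ∀ {s} (v : Vec Bool s) → count (lookup v) (toList (allFin s)) ≡ #true v
count-lookup≡#true [] = refl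
count-lookup≡#true {suc s} (x ∷ v) =
  trans (cong (count (lookup (x ∷ v))) (trans (sym (LP.map-id (toList (allFin (suc s))))) (map-allFin-suc (λ p → p))))
  (trans (count≡ΣL (lookup (x ∷ v)) (zero ∷ map suc (toList (allFin s))))
  (cong (λ z → ⟦ x ⟧ + z) (trans (sym (count≡ΣL (lookup (x ∷ v)) (map suc (toList (allFin s))))) (trans (count-map (lookup (x ∷ v)) suc (toList (allFin s))) (count-lookup≡#true v)))))

allV-snoc : ∀ {A : Set} {m} (p : A → Bool) (xs : Vec A m) z → allV p (xs ∷ʳ z) ≡ allV p xs ∧ p z
allV-snoc p [] z = ∧-identityʳ (p z)
allV-snoc p (x ∷ xs) z = trans (cong (p x ∧_) (allV-snoc p xs z)) (sym (∧-assoc (p x) _ _))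

allV-map : ∀ {A B : Set} {m} (p : B → Bool) (f : A → B) (xs : Vec A m) → allV p (Vec.map f xs) ≡ allV (p ∘ f) xs
allV-map p f [] = refl
allV-map p f (x ∷ xs) = cong (p (f x) ∧_) (allV-map p f xs)

orV-false⇒allV-not : ∀ {m} (x : Vec Bool m) → orV x ≡ false → allV not x ≡ true
orV-false⇒allV-not [] e = refl
orV-false⇒allV-not (false ∷ x) e = orV-false⇒allV-not x e

andV≡allV : ∀ {m} (row : Vec Bool m) → andV row ≡ allV (λ b → b) row
andV≡allV [] = refl
andV≡allV (x ∷ row) = cong (x ∧_) (andV≡allV row)

allV-id⇒lookup : ∀ {m} (row : Vec Bool m) → allV (λ b → b) row ≡ true → ∀ i → lookup row i ≡ true
allV-id⇒lookup (x ∷ row) h zero = ∧-true-l {x} {allV (λ b → b) row} h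
allV-id⇒lookup (x ∷ row) h (suc i) = allV-id⇒lookup row (∧-true-r {x} h) i

#true-∷ʳ : ∀ {m} (v : Vec Bool m) x → #true (v ∷ʳ x) ≡ #true v + ⟦ x ⟧
#true-∷ʳ [] x = +-identityʳ ⟦ x ⟧
#true-∷ʳ (y ∷ v) x = trans (cong (λ z → ⟦ y ⟧ + z) (#true-∷ʳ v x)) (sym (+-assoc ⟦ y ⟧ _ _))

lookup-false⇒allV-not : ∀ {m} (v : Vec Bool m) → (∀ i → lookup v i ≡ false) → allV not v ≡ true
lookup-false⇒allV-not [] h = refl
lookup-false⇒allV-not (x ∷ v) h rewrite h zero = lookup-false⇒allV-not v (λ i → h (suc i))

count-toℕ< : ∀ s f → f ≤ s → count (λ p → toℕ p <ᵇ f) (toList (allFin s)) ≡ f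
count-toℕ< zero zero z≤n = refl
count-toℕ< (suc s) zero z≤n = trans (cong (count (λ p → toℕ p <ᵇ 0)) (trans (sym (LP.map-id (toList (allFin (suc s))))) (map-allFin-suc (λ p → p))))
  (trans (count-map (λ p → toℕ p <ᵇ 0) suc (toList (allFin s))) (count-toℕ< s zero z≤n))
count-toℕ< (suc s) (suc f) (s≤s le) = trans (cong (count (λ p → toℕ p <ᵇ suc f)) (trans (sym (LP.map-id (toList (allFin (suc s))))) (map-allFin-suc (λ p → p))))
  (cong suc (trans (count-map (λ p → toℕ p <ᵇ suc f) suc (toList (allFin s))) (count-toℕ< s f le)))

firstTrue≤ : ∀ {s} (v : Vec Bool s) → orV v ≡ true → firstTrue v ≤ s
firstTrue≤ [] ()
firstTrue≤ (true ∷ v) e = z≤n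
firstTrue≤ (false ∷ v) e = s≤s (firstTrue≤ v e)

anyTrueWith⇒orV : ∀ {s} H (v : Vec Bool s) → anyTrueWith H v ≡ true → orV v ≡ true
anyTrueWith⇒orV H [] ()
anyTrueWith⇒orV H (true ∷ v) e = refl
anyTrueWith⇒orV H (false ∷ v) e = anyTrueWith⇒orV (H ∘ suc) v (trans (sym (anyTrueWith-∷ H false v)) e)

allFalse : ∀ r → Vec Bool r
allFalse r = replicate r false

allTrue : ∀ r → Vec Bool r
allTrue r = replicate r true

allV-not-allFalse : ∀ r → allV not (allFalse r) ≡ true
allV-not-allFalse zero = refl
allV-not-allFalse (suc r) = allV-not-allFalse r

orV-allFalse : ∀ r → orV (allFalse r) ≡ false
orV-allFalse zero = refl
orV-allFalse (suc r) = orV-allFalse r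

andV-allTrue : ∀ r → andV (allTrue r) ≡ true
andV-allTrue zero = refl
andV-allTrue (suc r) = andV-allTrue r

allV-not⇒allFalse : ∀ {m} (v : Vec Bool m) → allV not v ≡ true → v ≡ allFalse m
allV-not⇒allFalse [] h = refl
allV-not⇒allFalse (false ∷ v) h = cong (false ∷_) (allV-not⇒allFalse v h)

allV-id⇒allTrue : ∀ {m} (v : Vec Bool m) → allV (λ b → b) v ≡ true → v ≡ allTrue m
allV-id⇒allTrue [] h = refl
allV-id⇒allTrue (true ∷ v) h = cong (true ∷_) (allV-id⇒allTrue v h)

allV-allV-not⇒allFalse : ∀ {r m} (R : Vec (Vec Bool r) m) → allV (allV not) R ≡ true → R ≡ replicate m (allFalse r)
allV-allV-not⇒allFalse [] h = refl
allV-allV-not⇒allFalse (row ∷ R) h = cong₂ _∷_ (allV-not⇒allFalse row (∧-true-l {allV not row} {allV (allV not) R} h)) (allV-allV-not⇒allFalse R (∧-true-r {allV not row} h))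

<ᵇ-trans : ∀ a b c → (a <ᵇ b) ≡ true → (b <ᵇ c) ≡ true → (a <ᵇ c) ≡ true
<ᵇ-trans zero (suc b) (suc c) e1 e2 = refl
<ᵇ-trans (suc a) (suc b) (suc c) e1 e2 = <ᵇ-trans a b c e1 e2

<ᵇ-asym : ∀ a b → (a <ᵇ b) ≡ true → (b <ᵇ a) ≡ false
<ᵇ-asym zero (suc b) e = refl
<ᵇ-asym (suc a) (suc b) e = <ᵇ-asym a b e

<ᵇ-irr : ∀ a → (a <ᵇ a) ≡ false
<ᵇ-irr zero = refl
<ᵇ-irr (suc a) = <ᵇ-irr a

<ᵇ-suc-asym : ∀ x y → (x <ᵇ suc y) ≡ true → (y <ᵇ x) ≡ false
<ᵇ-suc-asym zero y e = refl
<ᵇ-suc-asym (suc x) zero ()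
<ᵇ-suc-asym (suc x) (suc y) e = <ᵇ-suc-asym x y e

toℕ<ᵇn : ∀ {n} (m : Fin n) → (toℕ m <ᵇ n) ≡ true
toℕ<ᵇn {suc n} zero = refl
toℕ<ᵇn {suc n} (suc m) = toℕ<ᵇn m

-<- : ∀ f p → ((- (+ f)) <ℤᵇ (- (+ p))) ≡ (p <ᵇ f)
-<- zero zero = refl
-<- zero (suc p) = refl
-<- (suc f) zero = refl
-<- (suc f) (suc p) = refl

-<+suc : ∀ p n → ((- (+ p)) <ℤᵇ (+ suc n)) ≡ true
-<+suc zero n = refl
-<+suc (suc p) n = refl

+≮- : ∀ x p → ((+ x) <ℤᵇ (- (+ p))) ≡ false
+≮- x zero = refl
+≮- x (suc p) = refl

-<+ : ∀ f y → (0 <ᵇ y) ≡ true → ((- (+ f)) <ℤᵇ (+ y)) ≡ true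
-<+ zero y e = e
-<+ (suc f) y e = refl

+1+≡1 : ∀ a b → a + 1 + b ≡ 1 → a ≡ 0 × b ≡ 0
+1+≡1 zero zero e = refl , refl
+1+≡1 zero (suc b) ()
+1+≡1 (suc a) b e with trans (sym (+-suc a b)) (suc-injective (trans (sym (+-assoc (suc a) 1 b)) e))
... | ()

-- Placing one copy of the new element

-- A copy (n+1)ᵢ of the new number is described by the vectors u and v recording which of
-- the J blocks and which of the sets S_1, …, S_s contain it.
inAllowedSlot : ∀ {s} → ℕ → Vec Bool s → Bool
inAllowedSlot {s} ai v = any (λ p → lookup v p ∧ (suc (toℕ p) <ᵇ suc ai)) (toList (allFin s))

validPlacement : ∀ {J s} → ℕ → Vec Bool J → Vec Bool s → Bool
validPlacement ai u v = (#true u + #true v ≡ᵇ 1) ∧ (orV u ∨ inAllowedSlot ai v)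

-- The weight is s_{(n+1)ᵢ}: in the block at position q the J ∸ suc q later blocks lie strictly
-- between its label and n + 1, in S_{p+1} all J blocks and S_1, …, S_p do.
placementWeight : ∀ {J s} → Vec Bool J → Vec Bool s → ℕ
placementWeight {J} u v = if orV u then J ∸ suc (firstTrue u) else J + firstTrue v

sum<-blockWeights : ∀ J x → sum< J (λ q → ⟦ J ∸ suc q ≡ᵇ x ⟧) ≡ ⟦ x <ᵇ J ⟧
sum<-blockWeights zero x = refl
sum<-blockWeights (suc J) x = trans (cong (_+_ (⟦ J ≡ᵇ x ⟧)) (sum<-blockWeights J x)) (⟦≡ᵇ⟧+⟦<ᵇ⟧ J x)

sum<-slotWeights : ∀ s ai J x → ai ≤ s → ⟦ x <ᵇ J ⟧ + sum< s (λ f → ⟦ f <ᵇ ai ⟧ * ⟦ J + f ≡ᵇ x ⟧) ≡ ⟦ x <ᵇ J + ai ⟧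
sum<-slotWeights s zero J x _ = trans (cong (_+_ (⟦ x <ᵇ J ⟧)) (sum<-zero s)) (trans (+-identityʳ _) (cong (λ y → ⟦ x <ᵇ y ⟧) (sym (+-identityʳ J))))
sum<-slotWeights (suc s) (suc ai) J x (s≤s le) =
  trans (cong (λ z → ⟦ x <ᵇ J ⟧ + (z + sum< s (λ f → ⟦ f <ᵇ ai ⟧ * ⟦ J + suc f ≡ᵇ x ⟧))) (trans (+-identityʳ _) (cong (λ y → ⟦ y ≡ᵇ x ⟧) (+-identityʳ J))))
  (trans (sym (+-assoc ⟦ x <ᵇ J ⟧ ⟦ J ≡ᵇ x ⟧ _))
  (trans (cong (_+ sum< s (λ f → ⟦ f <ᵇ ai ⟧ * ⟦ J + suc f ≡ᵇ x ⟧)) (trans (+-comm ⟦ x <ᵇ J ⟧ ⟦ J ≡ᵇ x ⟧) (⟦≡ᵇ⟧+⟦<ᵇ⟧ J x)))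
  (trans (cong (_+_ (⟦ x <ᵇ suc J ⟧)) (sum<-cong s (λ f → cong (λ y → ⟦ f <ᵇ ai ⟧ * ⟦ y ≡ᵇ x ⟧) (+-suc J f))))
  (trans (sum<-slotWeights s ai (suc J) x le) (cong (λ y → ⟦ x <ᵇ y ⟧) (sym (+-suc J ai)))))))

⟦validPlacement⟧ : ∀ {J s} ai (u : Vec Bool J) (v : Vec Bool s) x →
  ⟦ validPlacement ai u v ∧ (placementWeight u v ≡ᵇ x) ⟧ ≡
  ⟦ #true u ≡ᵇ 1 ⟧ * ⟦ J ∸ suc (firstTrue u) ≡ᵇ x ⟧ * ⟦ #true v ≡ᵇ 0 ⟧
  + ⟦ #true u ≡ᵇ 0 ⟧ * (⟦ #true v ≡ᵇ 1 ⟧ * (⟦ firstTrue v <ᵇ ai ⟧ * ⟦ J + firstTrue v ≡ᵇ x ⟧))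
⟦validPlacement⟧ {J} ai u v x with #true u in eu
... | zero rewrite orV-none u eu with #true v in ev
...   | zero = refl
...   | suc zero rewrite anyTrueWith-single (λ t → suc t <ᵇ suc ai) v ev with firstTrue v <ᵇ ai
...     | false = refl
...     | true with J + firstTrue v ≡ᵇ x
...       | true = refl
...       | false = refl
⟦validPlacement⟧ {J} ai u v x | zero | suc (suc c) = refl
⟦validPlacement⟧ {J} ai u v x | suc zero rewrite orV-some u eu with #true v | J ∸ suc (firstTrue u) ≡ᵇ x
...   | zero | true = refl
...   | zero | false = refl
...   | suc c | true = refl
...   | suc c | false = refl
⟦validPlacement⟧ {J} ai u v x | suc (suc c) = refl

ΣL-validPlacement≡qint : ∀ J s ai → ai ≤ s → ∀ x →
  ΣL (vecsOf bools J) (λ u → ΣL (vecsOf bools s) (λ v → ⟦ validPlacement ai u v ∧ (placementWeight u v ≡ᵇ x) ⟧)) ≡ qint (J + ai) x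
ΣL-validPlacement≡qint J s ai le x =
  trans (ΣL-cong (vecsOf bools J) sumOverSlots)
  (trans (ΣL-+ (vecsOf bools J) inBlock (λ u → ⟦ #true u ≡ᵇ 0 ⟧ * inSlots))
  (trans (cong₂ _+_ (ΣL-#true≡1 J blockTerm)
                    (trans (ΣL-*ʳ (vecsOf bools J) inSlots (λ u → ⟦ #true u ≡ᵇ 0 ⟧)) (trans (cong (_* inSlots) (ΣL-#true≡0 J)) (trans (+-identityʳ inSlots) (ΣL-#true≡1 s slotTerm)))))
  (trans (cong (_+ sum< s slotTerm) (sum<-blockWeights J x)) (sum<-slotWeights s ai J x le))))
  where
  blockTerm : ℕ → ℕ
  blockTerm q = ⟦ J ∸ suc q ≡ᵇ x ⟧
  slotTerm : ℕ → ℕ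
  slotTerm f = ⟦ f <ᵇ ai ⟧ * ⟦ J + f ≡ᵇ x ⟧
  inBlock : Vec Bool J → ℕ
  inBlock u = ⟦ #true u ≡ᵇ 1 ⟧ * blockTerm (firstTrue u)
  inSlots : ℕ
  inSlots = ΣL (vecsOf bools s) (λ v → ⟦ #true v ≡ᵇ 1 ⟧ * slotTerm (firstTrue v))
  sumOverSlots : ∀ u → ΣL (vecsOf bools s) (λ v → ⟦ validPlacement ai u v ∧ (placementWeight u v ≡ᵇ x) ⟧) ≡ inBlock u + ⟦ #true u ≡ᵇ 0 ⟧ * inSlots
  sumOverSlots u = trans (ΣL-cong (vecsOf bools s) (λ v → ⟦validPlacement⟧ ai u v x))
          (trans (ΣL-+ (vecsOf bools s) (λ v → inBlock u * ⟦ #true v ≡ᵇ 0 ⟧) (λ v → ⟦ #true u ≡ᵇ 0 ⟧ * (⟦ #true v ≡ᵇ 1 ⟧ * slotTerm (firstTrue v))))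
           (cong₂ _+_ (trans (ΣL-*ˡ (vecsOf bools s) (inBlock u) (λ v → ⟦ #true v ≡ᵇ 0 ⟧)) (trans (cong (inBlock u *_) (ΣL-#true≡0 s)) (*-identityʳ _)))
                      (ΣL-*ˡ (vecsOf bools s) ⟦ #true u ≡ᵇ 0 ⟧ (λ v → ⟦ #true v ≡ᵇ 1 ⟧ * slotTerm (firstTrue v)))))

-- Placing all copies: the factor ∏ᵢ [j + aᵢ]

module _ (J s : ℕ) where
  validColumns : ∀ {r} → (Fin r → ℕ) → Vec (Vec Bool J) r → Vec (Vec Bool s) r → Bool
  validColumns {r} a Cπ CS = all (λ i → validPlacement (a i) (lookup Cπ i) (lookup CS i)) (toList (allFin r))

  columnsWeight : ∀ {r} → Vec (Vec Bool J) r → Vec (Vec Bool s) r → ℕ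
  columnsWeight {r} Cπ CS = ΣL (toList (allFin r)) (λ i → placementWeight (lookup Cπ i) (lookup CS i))

  ΣL-validColumns≡prodP : ∀ r (a : Fin r → ℕ) → (∀ i → a i ≤ s) → ∀ t →
    ΣL (vecsOf (vecsOf bools J) r) (λ Cπ → ΣL (vecsOf (vecsOf bools s) r) (λ CS → ⟦ validColumns a Cπ CS ∧ (columnsWeight Cπ CS ≡ᵇ t) ⟧))
    ≡ prodP (λ i → qint (J + a i)) t
  ΣL-validColumns≡prodP zero a le zero = refl
  ΣL-validColumns≡prodP zero a le (suc t) = refl
  ΣL-validColumns≡prodP (suc r) a le t =
    trans (ΣL-vecsOf-∷ (vecsOf bools J) r _)
    (trans (ΣL-cong (vecsOf bools J) (λ u → ΣL-cong (vecsOf (vecsOf bools J) r) (λ Cπ → trans (ΣL-vecsOf-∷ (vecsOf bools s) r _)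
             (ΣL-cong (vecsOf bools s) (λ v → ΣL-cong (vecsOf (vecsOf bools s) r) (λ CS → ⟦validColumns-∷⟧ u Cπ v CS))))))
    (trans (ΣL-cong (vecsOf bools J) (λ u → ΣL-cong (vecsOf (vecsOf bools J) r) (λ Cπ →
              trans (ΣL-cong (vecsOf bools s) (λ v → ΣL-sumLe (vecsOf (vecsOf bools s) r) t _)) (ΣL-sumLe (vecsOf bools s) t _))))
    (trans (ΣL-cong (vecsOf bools J) (λ u → ΣL-sumLe (vecsOf (vecsOf bools J) r) t _))
    (trans (ΣL-sumLe (vecsOf bools J) t _)
    (sumLe-cong t (λ z → trans (ΣL⁴-separate (vecsOf bools J) (vecsOf (vecsOf bools J) r) (vecsOf bools s) (vecsOf (vecsOf bools s) r)
                                     (λ u v → ⟦ validPlacement (a zero) u v ∧ (placementWeight u v ≡ᵇ z) ⟧)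
                                     (λ Cπ CS → ⟦ validColumns (a ∘ suc) Cπ CS ∧ (columnsWeight Cπ CS ≡ᵇ t ∸ z) ⟧))
                          (cong₂ _*_ (ΣL-validPlacement≡qint J s (a zero) (le zero) z) (ΣL-validColumns≡prodP r (a ∘ suc) (le ∘ suc) (t ∸ z)))))))))
    where
    ⟦validColumns-∷⟧ : ∀ u Cπ v CS → ⟦ validColumns a (u ∷ Cπ) (v ∷ CS) ∧ (columnsWeight (u ∷ Cπ) (v ∷ CS) ≡ᵇ t) ⟧ ≡
         sumLe (λ z → ⟦ validPlacement (a zero) u v ∧ (placementWeight u v ≡ᵇ z) ⟧ * ⟦ validColumns (a ∘ suc) Cπ CS ∧ (columnsWeight Cπ CS ≡ᵇ t ∸ z) ⟧) t
    ⟦validColumns-∷⟧ u Cπ v CS = trans (cong₂ (λ b c → ⟦ b ∧ (c ≡ᵇ t) ⟧) (all-allFin-suc (λ i → validPlacement (a i) (lookup (u ∷ Cπ) i) (lookup (v ∷ CS) i)))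
                                                      (ΣL-allFin-suc (λ i → placementWeight (lookup (u ∷ Cπ) i) (lookup (v ∷ CS) i))))
                         (⟦+≡ᵇ⟧-sumLe (validPlacement (a zero) u v) (validColumns (a ∘ suc) Cπ CS) (placementWeight u v) (columnsWeight Cπ CS) t)

  validRows : ∀ {r} → (Fin r → ℕ) → Vec (Vec Bool r) J → Vec (Vec Bool r) s → Bool
  validRows {r} a Rπ RS = all (λ i → validPlacement (a i) (column Rπ i) (column RS i)) (toList (allFin r))

  rowsWeight : ∀ {r} → Vec (Vec Bool r) J → Vec (Vec Bool r) s → ℕ
  rowsWeight {r} Rπ RS = ΣL (toList (allFin r)) (λ i → placementWeight (column Rπ i) (column RS i))

  ΣL-validRows≡prodP : ∀ r (a : Fin r → ℕ) → (∀ i → a i ≤ s) → ∀ t →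
    ΣL (vecsOf (vecsOf bools r) J) (λ Rπ → ΣL (vecsOf (vecsOf bools r) s) (λ RS → ⟦ validRows a Rπ RS ∧ (rowsWeight Rπ RS ≡ᵇ t) ⟧))
    ≡ prodP (λ i → qint (J + a i)) t
  ΣL-validRows≡prodP r a le t =
    trans (ΣL-transpose J r _)
    (trans (ΣL-cong (vecsOf (vecsOf bools J) r) (λ Cπ → trans (ΣL-transpose s r _)
       (ΣL-cong (vecsOf (vecsOf bools s) r) (λ CS → cong₂ (λ b c → ⟦ b ∧ (c ≡ᵇ t) ⟧)
          (all-cong (toList (allFin r)) (λ i → cong₂ (validPlacement (a i)) (column-transpose Cπ i) (column-transpose CS i)))
          (ΣL-cong (toList (allFin r)) (λ i → cong₂ placementWeight (column-transpose Cπ i) (column-transpose CS i)))))))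
    (ΣL-validColumns≡prodP r a le t))

lookup-∷ʳ-inject₁ : ∀ {A : Set} {n} (b : Vec A n) (x : A) (m : Fin n) → lookup (b ∷ʳ x) (inject₁ m) ≡ lookup b m
lookup-∷ʳ-inject₁ (y ∷ b) x zero = refl
lookup-∷ʳ-inject₁ (y ∷ b) x (suc m) = lookup-∷ʳ-inject₁ b x m

lookup-∷ʳ-fromℕ : ∀ {A : Set} {n} (b : Vec A n) (x : A) → lookup (b ∷ʳ x) (fromℕ n) ≡ x
lookup-∷ʳ-fromℕ [] x = refl
lookup-∷ʳ-fromℕ (y ∷ b) x = lookup-∷ʳ-fromℕ b x

firstRowAfter : ∀ {n} → Maybe (Fin n) → Bool → Maybe (Fin (suc n))
firstRowAfter (just m) o = just (inject₁ m)
firstRowAfter {n} nothing o = if o then just (fromℕ n) else nothing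

firstRow-∷ʳ : ∀ {n r} (b : Sub n r) row → firstRow (b ∷ʳ row) ≡ firstRowAfter (firstRow b) (orV row)
firstRow-∷ʳ [] row with orV row
... | true = refl
... | false = refl
firstRow-∷ʳ (x ∷ b) row with orV x
... | true = refl
... | false rewrite firstRow-∷ʳ b row with firstRow b | orV row
...   | just m | _ = refl
...   | nothing | true = refl
...   | nothing | false = refl

nonEmpty : ∀ {n r} → Sub n r → Bool
nonEmpty b = maybe (λ _ → true) false (firstRow b)

cond1Block : ∀ {n r} → Sub n r → Bool
cond1Block b = maybe (λ m → andV (lookup b m)) false (firstRow b)

minPreserved : ∀ {n r} → Sub n r → Vec Bool r → Bool
minPreserved b row = nonEmpty b ∨ allV not row

minNum-∷ʳ : ∀ {n r} (b : Sub n r) row → minPreserved b row ≡ true → minNum (b ∷ʳ row) ≡ minNum b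
minNum-∷ʳ b row e rewrite firstRow-∷ʳ b row with firstRow b
... | just m = cong suc (toℕ-inject₁ m)
... | nothing rewrite allV-not⇒orV row e = refl

cond1Block-∷ʳ : ∀ {n r} (b : Sub n r) row → minPreserved b row ≡ true → cond1Block (b ∷ʳ row) ≡ cond1Block b
cond1Block-∷ʳ b row e rewrite firstRow-∷ʳ b row with firstRow b
... | just m = cong andV (lookup-∷ʳ-inject₁ b row m)
... | nothing rewrite allV-not⇒orV row e = refl

oldElem : ∀ {n r} → Fin n × Fin r → Fin (suc n) × Fin r
oldElem (m , i) = inject₁ m , i

newElem : ∀ {n r} → Fin r → Fin (suc n) × Fin r
newElem {n} i = fromℕ n , i

elems-suc : ∀ n r → elems (suc n) r ≡ map oldElem (elems n r) ++ map (newElem {n}) (toList (allFin r))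
elems-suc n r =
  trans (cong (concatMap rowF) (trans (sym (LP.map-id _)) (map-allFin-∷ʳ (λ m → m))))
  (trans (LP.concatMap-++ rowF (map inject₁ (toList (allFin n))) (fromℕ n ∷ []))
  (cong₂ _++_ (trans (LP.concatMap-map rowF inject₁ (toList (allFin n)))
                (trans (LP.concatMap-cong (λ _ → LP.map-∘ (toList (allFin r))) (toList (allFin n)))
                       (sym (LP.map-concatMap oldElem rowF' (toList (allFin n))))))
              (LP.++-identityʳ (rowF (fromℕ n)))))
  where
  rowF : Fin (suc n) → List (Fin (suc n) × Fin r)
  rowF m = map (λ i → m , i) (toList (allFin r))
  rowF' : Fin n → List (Fin n × Fin r)
  rowF' m = map (λ i → m , i) (toList (allFin r))

appendRows : ∀ {n r} → List (ℤ × Sub n r) → List (Vec Bool r) → List (ℤ × Sub (suc n) r)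
appendRows [] _ = []
appendRows (_ ∷ _) [] = []
appendRows ((l , b) ∷ L) (row ∷ R) = (l , b ∷ʳ row) ∷ appendRows L R

appendRows-++ : ∀ {n r} (A B : List (ℤ × Sub n r)) (C D : List (Vec Bool r)) → length A ≡ length C →
  appendRows (A ++ B) (C ++ D) ≡ appendRows A C ++ appendRows B D
appendRows-++ [] B [] D e = refl
appendRows-++ ((l , b) ∷ A) B (row ∷ C) D e = cong ((l , b ∷ʳ row) ∷_) (appendRows-++ A B C D (suc-injective e))

labelAt : List ℤ → List Bool → ℤ
labelAt [] _ = + 0
labelAt (_ ∷ _) [] = + 0
labelAt (l ∷ ls) (c ∷ cs) = if c then l else labelAt ls cs

module _ {n r : ℕ} where
  count-label-appendRows : (q : ℤ → Bool) (L : List (ℤ × Sub n r)) (R : List (Vec Bool r)) → length L ≡ length R →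
    count (λ A → q (proj₁ A)) (appendRows L R) ≡ count (λ A → q (proj₁ A)) L
  count-label-appendRows q [] [] e = refl
  count-label-appendRows q ((l , b) ∷ L) (row ∷ R) e with q l
  ... | true = cong suc (count-label-appendRows q L R (suc-injective e))
  ... | false = count-label-appendRows q L R (suc-injective e)

  labelOf-appendRows-old : (L : List (ℤ × Sub n r)) (R : List (Vec Bool r)) → length L ≡ length R → ∀ x →
    labelOf (appendRows L R) (oldElem x) ≡ labelOf L x
  labelOf-appendRows-old [] [] e x = refl
  labelOf-appendRows-old ((l , b) ∷ L) (row ∷ R) e (m , i)
    rewrite lookup-∷ʳ-inject₁ b row m | labelOf-appendRows-old L R (suc-injective e) (m , i) = refl

  count-mem-appendRows-old : (L : List (ℤ × Sub n r)) (R : List (Vec Bool r)) → length L ≡ length R → ∀ x →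
    count (λ A → mem (proj₂ A) (oldElem x)) (appendRows L R) ≡ count (λ A → mem (proj₂ A) x) L
  count-mem-appendRows-old [] [] e x = refl
  count-mem-appendRows-old ((l , b) ∷ L) (row ∷ R) e (m , i) rewrite lookup-∷ʳ-inject₁ b row m with lookup (lookup b m) i
  ... | true = cong suc (count-mem-appendRows-old L R (suc-injective e) (m , i))
  ... | false = count-mem-appendRows-old L R (suc-injective e) (m , i)

  count-mem-appendRows-new : (L : List (ℤ × Sub n r)) (R : List (Vec Bool r)) → length L ≡ length R → ∀ i →
    count (λ A → mem (proj₂ A) (newElem {n} i)) (appendRows L R) ≡ count (λ row → lookup row i) R
  count-mem-appendRows-new [] [] e i = refl
  count-mem-appendRows-new ((l , b) ∷ L) (row ∷ R) e i rewrite lookup-∷ʳ-fromℕ b row with lookup row i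
  ... | true = cong suc (count-mem-appendRows-new L R (suc-injective e) i)
  ... | false = count-mem-appendRows-new L R (suc-injective e) i

  labelOf-appendRows-new : (L : List (ℤ × Sub n r)) (R : List (Vec Bool r)) → length L ≡ length R → ∀ i →
    labelOf (appendRows L R) (newElem {n} i) ≡ labelAt (map proj₁ L) (map (λ row → lookup row i) R)
  labelOf-appendRows-new [] [] e i = refl
  labelOf-appendRows-new ((l , b) ∷ L) (row ∷ R) e i
    rewrite lookup-∷ʳ-fromℕ b row | labelOf-appendRows-new L R (suc-injective e) i = refl

extendSets : ∀ {n r m} → Vec (Sub n r) m → Vec (Vec Bool r) m → Vec (Sub (suc n) r) m
extendSets = zipWith _∷ʳ_

blockEntry : ∀ {n r} → Sub n r → ℤ × Sub n r
blockEntry b = (+ minNum b) , b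

slotEntry : ∀ {n r s} → Vec (Sub n r) s → Fin s → ℤ × Sub n r
slotEntry S p = (- (+ toℕ p)) , lookup S p

allNonEmpty : ∀ {n r m} → Vec (Sub n r) m → Bool
allNonEmpty π = all nonEmpty (toList π)

minsPreserved : ∀ {n r m} → Vec (Sub n r) m → Vec (Vec Bool r) m → Bool
minsPreserved [] [] = true
minsPreserved (b ∷ π) (row ∷ R) = minPreserved b row ∧ minsPreserved π R

allNonEmpty⇒minsPreserved : ∀ {n r m} (π : Vec (Sub n r) m) (R : Vec (Vec Bool r) m) → allNonEmpty π ≡ true → minsPreserved π R ≡ true
allNonEmpty⇒minsPreserved [] [] e = refl
allNonEmpty⇒minsPreserved (b ∷ π) (row ∷ R) e rewrite ∧-true-l {nonEmpty b} {allNonEmpty π} e = allNonEmpty⇒minsPreserved π R (∧-true-r {nonEmpty b} e)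

module _ {n r : ℕ} where
  blockEntries-extend : ∀ {m} (π : Vec (Sub n r) m) (R : Vec (Vec Bool r) m) → minsPreserved π R ≡ true →
    map blockEntry (toList (extendSets π R)) ≡ appendRows (map blockEntry (toList π)) (toList R)
  blockEntries-extend [] [] e = refl
  blockEntries-extend (b ∷ π) (row ∷ R) e =
    cong₂ _∷_ (cong (λ z → (+ z) , b ∷ʳ row) (minNum-∷ʳ b row (∧-true-l {minPreserved b row} e))) (blockEntries-extend π R (∧-true-r {minPreserved b row} e))

  slotEntries-extend : ∀ {s} (f : Fin s → ℤ) (S : Vec (Sub n r) s) (R : Vec (Vec Bool r) s) →
    map (λ p → f p , lookup (extendSets S R) p) (toList (allFin s)) ≡ appendRows (map (λ p → f p , lookup S p) (toList (allFin s))) (toList R)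
  slotEntries-extend f [] [] = refl
  slotEntries-extend f (b ∷ S) (row ∷ R) =
    trans (map-allFin-suc (λ p → f p , lookup (extendSets (b ∷ S) (row ∷ R)) p))
    (trans (cong (_ ∷_) (slotEntries-extend (f ∘ suc) S R))
    (cong (λ z → appendRows z (row ∷ toList R)) (sym (map-allFin-suc (λ p → f p , lookup (b ∷ S) p)))))

  length-blockEntries : ∀ {m} (π : Vec (Sub n r) m) → length (map blockEntry (toList π)) ≡ m
  length-blockEntries π = trans (LP.length-map _ (toList π)) (VP.length-toList π)

  labelled-extend : ∀ {J s} (π : Vec (Sub n r) J) (S : Vec (Sub n r) s) (Rπ : Vec (Vec Bool r) J) (RS : Vec (Vec Bool r) s) → minsPreserved π Rπ ≡ true →
    labelled (extendSets π Rπ , extendSets S RS) ≡ appendRows (labelled (π , S)) (toList Rπ ++ toList RS)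
  labelled-extend {J} {s} π S Rπ RS e =
    trans (cong₂ _++_ (blockEntries-extend π Rπ e) (slotEntries-extend (λ p → - (+ toℕ p)) S RS))
          (sym (appendRows-++ (map blockEntry (toList π)) (map (slotEntry S) (toList (allFin s))) (toList Rπ) (toList RS) (trans (length-blockEntries π) (sym (VP.length-toList Rπ)))))

  length-labelled : ∀ {J s} (π : Vec (Sub n r) J) (S : Vec (Sub n r) s) (Rπ : Vec (Vec Bool r) J) (RS : Vec (Vec Bool r) s) →
    length (labelled (π , S)) ≡ length (toList Rπ ++ toList RS)
  length-labelled {J} {s} π S Rπ RS =
    trans (LP.length-++ (map blockEntry (toList π)) {map (slotEntry S) (toList (allFin s))})
    (trans (cong₂ _+_ (length-blockEntries π) (trans (LP.length-map (slotEntry S) (toList (allFin s))) (VP.length-toList (allFin s))))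
      (sym (trans (LP.length-++ (toList Rπ) {toList RS}) (cong₂ _+_ (VP.length-toList Rπ) (VP.length-toList RS)))))

  count-column : ∀ {m} (R : Vec (Vec Bool r) m) i → count (λ row → lookup row i) (toList R) ≡ #true (column R i)
  count-column [] i = refl
  count-column (row ∷ R) i with lookup row i
  ... | true = cong suc (count-column R i)
  ... | false = count-column R i

  disjointCover-extend : ∀ {J s} (π : Vec (Sub n r) J) (S : Vec (Sub n r) s) (Rπ : Vec (Vec Bool r) J) (RS : Vec (Vec Bool r) s) → minsPreserved π Rπ ≡ true →
    disjointCover (extendSets π Rπ , extendSets S RS) ≡
    disjointCover (π , S) ∧ all (λ i → #true (column Rπ i) + #true (column RS i) ≡ᵇ 1) (toList (allFin r))
  disjointCover-extend {J} {s} π S Rπ RS e =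
    trans (cong (λ L → all (λ x → count (λ A → mem (proj₂ A) x) L ≡ᵇ 1) (elems (suc n) r)) (labelled-extend π S Rπ RS e))
    (trans (cong (all _) (elems-suc n r))
    (trans (all-++ _ (map oldElem (elems n r)) _)
    (cong₂ _∧_ (trans (all-map _ oldElem (elems n r)) (all-cong (elems n r) (λ x → cong (_≡ᵇ 1) (count-mem-appendRows-old Lp rows len x))))
               (trans (all-map _ newElem (toList (allFin r))) (all-cong (toList (allFin r)) (λ i → cong (_≡ᵇ 1)
                  (trans (count-mem-appendRows-new Lp rows len i) (trans (count-++ _ (toList Rπ) (toList RS)) (cong₂ _+_ (count-column Rπ i) (count-column RS i))))))))))
    where
    Lp = labelled (π , S)
    rows = toList Rπ ++ toList RS
    len = length-labelled π S Rπ RS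

  anyBlock-oldElem : ∀ {m} (π : Vec (Sub n r) m) (R : Vec (Vec Bool r) m) x →
    any (λ b → mem b (oldElem x)) (toList (extendSets π R)) ≡ any (λ b → mem b x) (toList π)
  anyBlock-oldElem [] [] x = refl
  anyBlock-oldElem (b ∷ π) (row ∷ R) (m , i) rewrite lookup-∷ʳ-inject₁ b row m = cong (_ ∨_) (anyBlock-oldElem π R (m , i))

  anyBlock-newElem : ∀ {m} (π : Vec (Sub n r) m) (R : Vec (Vec Bool r) m) i →
    any (λ b → mem b (newElem {n} i)) (toList (extendSets π R)) ≡ orV (column R i)
  anyBlock-newElem [] [] i = refl
  anyBlock-newElem (b ∷ π) (row ∷ R) i rewrite lookup-∷ʳ-fromℕ b row = cong (_ ∨_) (anyBlock-newElem π R i)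

  mem-slot-oldElem : ∀ {s} (S : Vec (Sub n r) s) (R : Vec (Vec Bool r) s) p x →
    mem (lookup (extendSets S R) p) (oldElem x) ≡ mem (lookup S p) x
  mem-slot-oldElem S R p (m , i) rewrite VP.lookup-zipWith _∷ʳ_ p S R | lookup-∷ʳ-inject₁ (lookup S p) (lookup R p) m = refl

  mem-slot-newElem : ∀ {s} (S : Vec (Sub n r) s) (R : Vec (Vec Bool r) s) p i →
    mem (lookup (extendSets S R) p) (newElem {n} i) ≡ lookup (column R i) p
  mem-slot-newElem S R p i rewrite VP.lookup-zipWith _∷ʳ_ p S R | lookup-∷ʳ-fromℕ (lookup S p) (lookup R p)
    = sym (VP.lookup-map p (λ row → lookup row i) R)

  cond3-extend : ∀ {J s} (a : Fin r → ℕ) (π : Vec (Sub n r) J) (S : Vec (Sub n r) s) (Rπ : Vec (Vec Bool r) J) (RS : Vec (Vec Bool r) s) →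
    cond3 a (extendSets π Rπ , extendSets S RS) ≡
    cond3 a (π , S) ∧ all (λ i → orV (column Rπ i) ∨ inAllowedSlot (a i) (column RS i)) (toList (allFin r))
  cond3-extend {J} {s} a π S Rπ RS =
    trans (cong (all _) (elems-suc n r))
    (trans (all-++ _ (map oldElem (elems n r)) _)
    (cong₂ _∧_ (trans (all-map _ oldElem (elems n r)) (all-cong (elems n r) (λ x →
                   cong₂ _∨_ (anyBlock-oldElem π Rπ x) (any-cong (toList (allFin s)) (λ p → cong (_∧ _) (mem-slot-oldElem S RS p x))))))
               (trans (all-map _ newElem (toList (allFin r))) (all-cong (toList (allFin r)) (λ i →
                   cong₂ _∨_ (anyBlock-newElem π Rπ i) (any-cong (toList (allFin s)) (λ p → cong (_∧ _) (mem-slot-newElem S RS p i))))))))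

  cond1-extend : ∀ {J s} (π : Vec (Sub n r) J) (S : Vec (Sub n r) s) (Rπ : Vec (Vec Bool r) J) (RS : Vec (Vec Bool r) s) →
    minsPreserved π Rπ ≡ true → cond1 (extendSets π Rπ , extendSets S RS) ≡ cond1 (π , S)
  cond1-extend [] S [] RS e = refl
  cond1-extend (b ∷ π) S (row ∷ Rπ) RS e = cong₂ _∧_ (cond1Block-∷ʳ b row (∧-true-l {minPreserved b row} e)) (cond1-extend π S Rπ RS (∧-true-r {minPreserved b row} e))

  increasing-extend : ∀ {J} (π : Vec (Sub n r) J) (Rπ : Vec (Vec Bool r) J) → minsPreserved π Rπ ≡ true → increasing (extendSets π Rπ) ≡ increasing π
  increasing-extend [] [] e = refl
  increasing-extend (b ∷ []) (row ∷ []) e = refl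
  increasing-extend (b ∷ b' ∷ π) (row ∷ row' ∷ Rπ) e =
    cong₂ _∧_ (cong₂ _<ᵇ_ (minNum-∷ʳ b row (∧-true-l {minPreserved b row} e)) (minNum-∷ʳ b' row' (∧-true-l {minPreserved b' row'} (∧-true-r {minPreserved b row} e))))
              (increasing-extend (b' ∷ π) (row' ∷ Rπ) (∧-true-r {minPreserved b row} e))

cond2-extend : ∀ {n r j s} (π : Vec (Sub n r) (suc j)) (S : Vec (Sub n r) s) (Rπ : Vec (Vec Bool r) (suc j)) (RS : Vec (Vec Bool r) s) →
  allNonEmpty π ≡ true → cond2 (extendSets π Rπ , extendSets S RS) ≡ cond2 (π , S)
cond2-extend {zero} ([] ∷ π) S Rπ RS ()
cond2-extend {suc n} {r} π S Rπ RS e = go π Rπ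
  where
  go : ∀ {m} (π : Vec (Sub (suc n) r) m) (Rπ : Vec (Vec Bool r) m) → any (λ b → andV (lookup b zero)) (toList (extendSets π Rπ)) ≡ any (λ b → andV (lookup b zero)) (toList π)
  go [] [] = refl
  go ((x ∷ b) ∷ π) (row ∷ Rπ) = cong (_ ∨_) (go π Rπ)

module _ {n r : ℕ} where
  newElemWeight : List (ℤ × Sub n r) → List (Vec Bool r) → Fin r → ℕ
  newElemWeight Lp rows i = count (λ A → (labelAt (map proj₁ Lp) (map (λ row → lookup row i) rows) <ℤᵇ proj₁ A) ∧ (proj₁ A <ℤᵇ (+ suc n))) Lp

  sPSummand : ∀ {m} → List (ℤ × Sub m r) → Fin m × Fin r → ℕ
  sPSummand L x = count (λ A → (labelOf L x <ℤᵇ proj₁ A) ∧ (proj₁ A <ℤᵇ (+ suc (toℕ (proj₁ x))))) L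

  sP-extend : ∀ {J s} (π : Vec (Sub n r) J) (S : Vec (Sub n r) s) (Rπ : Vec (Vec Bool r) J) (RS : Vec (Vec Bool r) s) →
    minsPreserved π Rπ ≡ true →
    sP (extendSets π Rπ , extendSets S RS) ≡ sP (π , S) + ΣL (toList (allFin r)) (newElemWeight (labelled (π , S)) (toList Rπ ++ toList RS))
  sP-extend {J} {s} π S Rπ RS e =
    trans (sum-map≡ΣL (sPSummand L) (elems (suc n) r))
    (trans (cong (λ z → ΣL z (sPSummand L)) (elems-suc n r))
    (trans (ΣL-++ (map oldElem (elems n r)) _ (sPSummand L))
    (cong₂ _+_ (trans (ΣL-map oldElem (elems n r) (sPSummand L)) (trans (ΣL-cong (elems n r) old) (sym (sum-map≡ΣL (sPSummand Lp) (elems n r)))))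
               (trans (ΣL-map newElem (toList (allFin r)) (sPSummand L)) (ΣL-cong (toList (allFin r)) new)))))
    where
    Lp = labelled (π , S)
    rows = toList Rπ ++ toList RS
    len = length-labelled π S Rπ RS
    L = labelled (extendSets π Rπ , extendSets S RS)
    LZ : L ≡ appendRows Lp rows
    LZ = labelled-extend π S Rπ RS e
    old : ∀ x → sPSummand L (oldElem x) ≡ sPSummand Lp x
    old (m , i) rewrite LZ | labelOf-appendRows-old Lp rows len (m , i) | toℕ-inject₁ m =
      count-label-appendRows (λ l → (labelOf Lp (m , i) <ℤᵇ l) ∧ (l <ℤᵇ (+ suc (toℕ m)))) Lp rows len
    new : ∀ i → sPSummand L (newElem {n} i) ≡ newElemWeight Lp rows i
    new i rewrite LZ | labelOf-appendRows-new Lp rows len i | toℕ-fromℕ n =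
      count-label-appendRows (λ l → (labelAt (map proj₁ Lp) (map (λ row → lookup row i) rows) <ℤᵇ l) ∧ (l <ℤᵇ (+ suc n))) Lp rows len

-- The contribution of the new element to s_P

strictlyIncreasing : ∀ {m} → Vec ℕ m → Bool
strictlyIncreasing [] = true
strictlyIncreasing (x ∷ []) = true
strictlyIncreasing (x ∷ y ∷ xs) = (x <ᵇ y) ∧ strictlyIncreasing (y ∷ xs)

pick : ∀ {m} → Vec ℕ m → Vec Bool m → ℕ
pick [] [] = 0
pick (x ∷ xs) (b ∷ bs) = if b then x else pick xs bs

labelAt-blocks : ∀ {m} (ms : Vec ℕ m) (u : Vec Bool m) → labelAt (map +_ (toList ms)) (toList u) ≡ + pick ms u
labelAt-blocks [] [] = refl
labelAt-blocks (x ∷ ms) (true ∷ u) = refl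
labelAt-blocks (x ∷ ms) (false ∷ u) = labelAt-blocks ms u

labelAt-++ : ∀ {m} (ms : Vec ℕ m) (u : Vec Bool m) (ys : List ℤ) (ds : List Bool) →
  labelAt (map +_ (toList ms) ++ ys) (toList u ++ ds) ≡ (if orV u then labelAt (map +_ (toList ms)) (toList u) else labelAt ys ds)
labelAt-++ [] [] ys ds = refl
labelAt-++ (x ∷ ms) (true ∷ u) ys ds = refl
labelAt-++ (x ∷ ms) (false ∷ u) ys ds = labelAt-++ ms u ys ds

labelAt-slots : ∀ {s} (f : ℕ → ℤ) (v : Vec Bool s) → orV v ≡ true →
  labelAt (map (λ p → f (toℕ p)) (toList (allFin s))) (toList v) ≡ f (firstTrue v)
labelAt-slots f [] ()
labelAt-slots {suc s} f (true ∷ v) e = cong (λ z → labelAt z (true ∷ toList v)) (map-allFin-suc {m = s} (λ p → f (toℕ p)))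
labelAt-slots {suc s} f (false ∷ v) e =
  trans (cong (λ z → labelAt z (false ∷ toList v)) (map-allFin-suc {m = s} (λ p → f (toℕ p)))) (labelAt-slots (f ∘ suc) v e)

countSlots-aboveBlock : ∀ s x n → count (λ l → ((+ x) <ℤᵇ l) ∧ (l <ℤᵇ (+ suc n))) (map (λ p → - (+ toℕ p)) (toList (allFin s))) ≡ 0
countSlots-aboveBlock s x n = trans (count-map _ (λ p → - (+ toℕ p)) (toList (allFin s)))
  (trans (count-cong (toList (allFin s)) (λ p → cong (_∧ _) (+≮- x (toℕ p)))) (count-none _ (toList (allFin s)) (λ _ → refl)))

countSlots-aboveSlot : ∀ s f n → f ≤ s → count (λ l → ((- (+ f)) <ℤᵇ l) ∧ (l <ℤᵇ (+ suc n))) (map (λ p → - (+ toℕ p)) (toList (allFin s))) ≡ f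
countSlots-aboveSlot s f n le = trans (count-map _ (λ p → - (+ toℕ p)) (toList (allFin s)))
  (trans (count-cong (toList (allFin s)) (λ p → trans (cong₂ _∧_ (-<- f (toℕ p)) (-<+suc (toℕ p) n)) (∧-identityʳ _))) (count-toℕ< s f le))

allAbove : ∀ {m} → ℕ → Vec ℕ m → Bool
allAbove x ms = allV (λ y → x <ᵇ y) ms

strictlyIncreasing-head : ∀ {m} x (ms : Vec ℕ m) → strictlyIncreasing (x ∷ ms) ≡ true → allAbove x ms ≡ true
strictlyIncreasing-head x [] e = refl
strictlyIncreasing-head x (y ∷ ms) e = cong₂ _∧_ (∧-true-l {x <ᵇ y} {strictlyIncreasing (y ∷ ms)} e) (go ms (strictlyIncreasing-head y ms (∧-true-r {x <ᵇ y} e)))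
  where
  go : ∀ {k} (zs : Vec ℕ k) → allAbove y zs ≡ true → allAbove x zs ≡ true
  go [] _ = refl
  go (z ∷ zs) h = cong₂ _∧_ (<ᵇ-trans x y z (∧-true-l {x <ᵇ y} {strictlyIncreasing (y ∷ ms)} e) (∧-true-l {y <ᵇ z} {allAbove y zs} h)) (go zs (∧-true-r {y <ᵇ z} h))

strictlyIncreasing-tail : ∀ {m} x (ms : Vec ℕ m) → strictlyIncreasing (x ∷ ms) ≡ true → strictlyIncreasing ms ≡ true
strictlyIncreasing-tail x [] e = refl
strictlyIncreasing-tail x (y ∷ ms) e = ∧-true-r {x <ᵇ y} e

pick-above : ∀ {m} x (ms : Vec ℕ m) (u : Vec Bool m) → orV u ≡ true → allAbove x ms ≡ true → (x <ᵇ pick ms u) ≡ true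
pick-above x [] [] () h
pick-above x (y ∷ ms) (true ∷ u) e h = ∧-true-l {x <ᵇ y} {allAbove x ms} h
pick-above x (y ∷ ms) (false ∷ u) e h = pick-above x ms u e (∧-true-r {x <ᵇ y} h)

countBlocks-allAbove : ∀ n {m} x (ms : Vec ℕ m) → allAbove x ms ≡ true → allV (λ y → y <ᵇ suc n) ms ≡ true →
  count (λ l → ((+ x) <ℤᵇ l) ∧ (l <ℤᵇ (+ suc n))) (map +_ (toList ms)) ≡ m
countBlocks-allAbove n x [] h1 h2 = refl
countBlocks-allAbove n x (y ∷ ms) h1 h2 =
  trans (count-∷-true (λ l → ((+ x) <ℤᵇ l) ∧ (l <ℤᵇ (+ suc n))) (+ y) (map +_ (toList ms))
           (cong₂ _∧_ (∧-true-l {x <ᵇ y} {allAbove x ms} h1) (∧-true-l {y <ᵇ suc n} {allV (λ y → y <ᵇ suc n) ms} h2)))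
        (cong suc (countBlocks-allAbove n x ms (∧-true-r {x <ᵇ y} h1) (∧-true-r {y <ᵇ suc n} h2)))

countBlocks-aboveBlock : ∀ n {m} (ms : Vec ℕ m) (u : Vec Bool m) → orV u ≡ true → strictlyIncreasing ms ≡ true → allV (λ y → y <ᵇ suc n) ms ≡ true →
  count (λ l → ((+ pick ms u) <ℤᵇ l) ∧ (l <ℤᵇ (+ suc n))) (map +_ (toList ms)) ≡ m ∸ suc (firstTrue u)
countBlocks-aboveBlock n [] [] () h1 h2
countBlocks-aboveBlock n (x ∷ ms) (true ∷ u) e h1 h2 =
  trans (count-∷-false (λ l → ((+ x) <ℤᵇ l) ∧ (l <ℤᵇ (+ suc n))) (+ x) (map +_ (toList ms)) (cong (_∧ (x <ᵇ suc n)) (<ᵇ-irr x)))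
        (countBlocks-allAbove n x ms (strictlyIncreasing-head x ms h1) (∧-true-r {x <ᵇ suc n} h2))
countBlocks-aboveBlock n (x ∷ ms) (false ∷ u) e h1 h2 =
  trans (count-∷-false (λ l → ((+ pick ms u) <ℤᵇ l) ∧ (l <ℤᵇ (+ suc n))) (+ x) (map +_ (toList ms))
           (cong (_∧ (x <ᵇ suc n)) (<ᵇ-asym x (pick ms u) (pick-above x ms u e (strictlyIncreasing-head x ms h1)))))
  (countBlocks-aboveBlock n ms u e (strictlyIncreasing-tail x ms h1) (∧-true-r {x <ᵇ suc n} h2))

countBlocks-aboveSlot : ∀ n {m} f (ms : Vec ℕ m) → allV (λ y → 0 <ᵇ y) ms ≡ true → allV (λ y → y <ᵇ suc n) ms ≡ true →
  count (λ l → ((- (+ f)) <ℤᵇ l) ∧ (l <ℤᵇ (+ suc n))) (map +_ (toList ms)) ≡ m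
countBlocks-aboveSlot n f [] h1 h2 = refl
countBlocks-aboveSlot n f (y ∷ ms) h1 h2 =
  trans (count-∷-true (λ l → ((- (+ f)) <ℤᵇ l) ∧ (l <ℤᵇ (+ suc n))) (+ y) (map +_ (toList ms))
           (cong₂ _∧_ (-<+ f y (∧-true-l {0 <ᵇ y} {allV (λ y → 0 <ᵇ y) ms} h1)) (∧-true-l {y <ᵇ suc n} {allV (λ y → y <ᵇ suc n) ms} h2)))
        (cong suc (countBlocks-aboveSlot n f ms (∧-true-r {0 <ᵇ y} h1) (∧-true-r {y <ᵇ suc n} h2)))

slotLabels : ℕ → List ℤ
slotLabels s = map (λ p → - (+ toℕ p)) (toList (allFin s))

countBetween≡placementWeight : ∀ {J s} n (ms : Vec ℕ J) (u : Vec Bool J) (v : Vec Bool s) → strictlyIncreasing ms ≡ true →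
  allV (λ y → 0 <ᵇ y) ms ≡ true → allV (λ y → y <ᵇ suc n) ms ≡ true → (orV u ∨ orV v) ≡ true →
  count (λ l → (labelAt (map +_ (toList ms) ++ slotLabels s) (toList u ++ toList v) <ℤᵇ l) ∧ (l <ℤᵇ (+ suc n))) (map +_ (toList ms) ++ slotLabels s)
  ≡ placementWeight u v
countBetween≡placementWeight {J} {s} n ms u v hi h0 hn e rewrite labelAt-++ ms u (slotLabels s) (toList v) with orV u in eu
... | true rewrite labelAt-blocks ms u = trans (count-++ _ (map +_ (toList ms)) (slotLabels s))
        (trans (cong₂ _+_ (countBlocks-aboveBlock n ms u eu hi hn) (countSlots-aboveBlock s (pick ms u) n)) (+-identityʳ _))
... | false rewrite labelAt-slots (λ p → - (+ p)) v e = trans (count-++ _ (map +_ (toList ms)) (slotLabels s))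
        (cong₂ _+_ (countBlocks-aboveSlot n (firstTrue v) ms h0 hn) (countSlots-aboveSlot s (firstTrue v) n (firstTrue≤ v e)))

minNum≤n : ∀ {n r} (b : Sub n r) → (minNum b <ᵇ suc n) ≡ true
minNum≤n b with firstRow b
... | just m = toℕ<ᵇn m
... | nothing = refl

minNum>0 : ∀ {n r} (b : Sub n r) → nonEmpty b ≡ true → (0 <ᵇ minNum b) ≡ true
minNum>0 b e with firstRow b
... | just m = refl

cond1Block⇒nonEmpty : ∀ {n r} (b : Sub n r) → cond1Block b ≡ true → nonEmpty b ≡ true
cond1Block⇒nonEmpty b e with firstRow b
... | just m = refl

cond1⇒allNonEmpty : ∀ {n r m} (π : Vec (Sub n r) m) → all cond1Block (toList π) ≡ true → allNonEmpty π ≡ true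
cond1⇒allNonEmpty [] e = refl
cond1⇒allNonEmpty (b ∷ π) e = cong₂ _∧_ (cond1Block⇒nonEmpty b (∧-true-l {cond1Block b} {all cond1Block (toList π)} e)) (cond1⇒allNonEmpty π (∧-true-r {cond1Block b} e))

strictlyIncreasing-minNums : ∀ {n r m} (π : Vec (Sub n r) m) → strictlyIncreasing (Vec.map minNum π) ≡ increasing π
strictlyIncreasing-minNums [] = refl
strictlyIncreasing-minNums (b ∷ []) = refl
strictlyIncreasing-minNums (b ∷ b' ∷ π) = cong ((minNum b <ᵇ minNum b') ∧_) (strictlyIncreasing-minNums (b' ∷ π))

allNonEmpty⇒minNums>0 : ∀ {n r m} (π : Vec (Sub n r) m) → allNonEmpty π ≡ true → allV (λ y → 0 <ᵇ y) (Vec.map minNum π) ≡ true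
allNonEmpty⇒minNums>0 [] e = refl
allNonEmpty⇒minNums>0 (b ∷ π) e = cong₂ _∧_ (minNum>0 b (∧-true-l {nonEmpty b} {allNonEmpty π} e)) (allNonEmpty⇒minNums>0 π (∧-true-r {nonEmpty b} e))

minNums≤n : ∀ {n r m} (π : Vec (Sub n r) m) → allV (λ y → y <ᵇ suc n) (Vec.map minNum π) ≡ true
minNums≤n [] = refl
minNums≤n (b ∷ π) = cong₂ _∧_ (minNum≤n b) (minNums≤n π)

validPlacement⇒placed : ∀ {J s} ai (u : Vec Bool J) (v : Vec Bool s) → validPlacement ai u v ≡ true → (orV u ∨ orV v) ≡ true
validPlacement⇒placed ai u v e with orV u | ∧-true-r {#true u + #true v ≡ᵇ 1} e
... | true | _ = refl
... | false | e2 = anyTrueWith⇒orV (λ t → suc t <ᵇ suc ai) v e2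

labels-labelled : ∀ {n r J s} (π : Vec (Sub n r) J) (S : Vec (Sub n r) s) →
  map proj₁ (labelled (π , S)) ≡ map (λ x → + x) (toList (Vec.map minNum π)) ++ slotLabels s
labels-labelled {s = s} π S =
  trans (LP.map-++ proj₁ (map blockEntry (toList π)) (map (slotEntry S) (toList (allFin s))))
  (cong₂ _++_ (trans (sym (LP.map-∘ (toList π))) (trans (LP.map-∘ (toList π)) (cong (map (λ x → + x)) (sym (VP.toList-map minNum π)))))
              (sym (LP.map-∘ (toList (allFin s)))))

map-lookup-rows : ∀ {r J s} (Rπ : Vec (Vec Bool r) J) (RS : Vec (Vec Bool r) s) i →
  map (λ row → lookup row i) (toList Rπ ++ toList RS) ≡ toList (column Rπ i) ++ toList (column RS i)
map-lookup-rows Rπ RS i = trans (LP.map-++ (λ row → lookup row i) (toList Rπ) (toList RS))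
  (sym (cong₂ _++_ (VP.toList-map (λ row → lookup row i) Rπ) (VP.toList-map (λ row → lookup row i) RS)))

newElemWeight≡placementWeight : ∀ {n r J s} (π : Vec (Sub n r) J) (S : Vec (Sub n r) s) (Rπ : Vec (Vec Bool r) J) (RS : Vec (Vec Bool r) s) i →
  increasing π ≡ true → allNonEmpty π ≡ true → (orV (column Rπ i) ∨ orV (column RS i)) ≡ true →
  newElemWeight (labelled (π , S)) (toList Rπ ++ toList RS) i ≡ placementWeight (column Rπ i) (column RS i)
newElemWeight≡placementWeight {n} {r} {J} {s} π S Rπ RS i hinc hne hor =
  trans (sym (count-map (λ l → (labelAt (map proj₁ Lp) (map (λ row → lookup row i) (toList Rπ ++ toList RS)) <ℤᵇ l) ∧ (l <ℤᵇ (+ suc n))) proj₁ Lp))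
  (trans (cong₂ (λ LS CL → count (λ l → (labelAt LS CL <ℤᵇ l) ∧ (l <ℤᵇ (+ suc n))) LS) (labels-labelled π S) (map-lookup-rows Rπ RS i))
  (countBetween≡placementWeight n (Vec.map minNum π) (column Rπ i) (column RS i) (trans (strictlyIncreasing-minNums π) hinc) (allNonEmpty⇒minNums>0 π hne) (minNums≤n π) hor))
  where
  Lp = labelled (π , S)

-- All blocks of π stay nonempty

⟦∧⟧-regroup : ∀ d D c1 c2 c3 C i e → ⟦ ((d ∧ D) ∧ c1 ∧ c2 ∧ (c3 ∧ C) ∧ i) ∧ e ⟧ ≡ ⟦ d ∧ c1 ∧ c2 ∧ c3 ∧ i ⟧ * ⟦ (D ∧ C) ∧ e ⟧
⟦∧⟧-regroup false D c1 c2 c3 C i e = refl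
⟦∧⟧-regroup true false c1 c2 c3 C i e = sym (*-zeroʳ ⟦ c1 ∧ c2 ∧ c3 ∧ i ⟧)
⟦∧⟧-regroup true true false c2 c3 C i e = refl
⟦∧⟧-regroup true true true false c3 C i e = refl
⟦∧⟧-regroup true true true true false C i e = refl
⟦∧⟧-regroup true true true true true false i e = sym (*-zeroʳ ⟦ i ⟧)
⟦∧⟧-regroup true true true true true true false e = refl
⟦∧⟧-regroup true true true true true true true e = sym (+-identityʳ ⟦ e ⟧)

⟦∧+≡ᵇ⟧-cong : ∀ v g A X Y k → (v ≡ true → g ≡ true → X ≡ Y) → ⟦ v ⟧ * ⟦ g ∧ (A + X ≡ᵇ k) ⟧ ≡ ⟦ v ⟧ * ⟦ g ∧ (A + Y ≡ᵇ k) ⟧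
⟦∧+≡ᵇ⟧-cong false g A X Y k h = refl
⟦∧+≡ᵇ⟧-cong true false A X Y k h = refl
⟦∧+≡ᵇ⟧-cong true true A X Y k h = cong (λ z → ⟦ true ⟧ * ⟦ true ∧ (A + z ≡ᵇ k) ⟧) (h refl refl)

⟦stirling⟧-extend-nonEmpty : ∀ {n r j s} (a : Fin r → ℕ) k (π : Vec (Sub n r) (suc j)) (S : Vec (Sub n r) s) (Rπ : Vec (Vec Bool r) (suc j)) (RS : Vec (Vec Bool r) s) →
  allNonEmpty π ≡ true →
  ⟦ isFStirling a (extendSets π Rπ , extendSets S RS) ∧ (sP (extendSets π Rπ , extendSets S RS) ≡ᵇ k) ⟧ ≡
  ⟦ isFStirling a (π , S) ⟧ * ⟦ validRows (suc j) s a Rπ RS ∧ (sP (π , S) + rowsWeight (suc j) s Rπ RS ≡ᵇ k) ⟧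
⟦stirling⟧-extend-nonEmpty {n} {r} {j} {s} a k π S Rπ RS e =
  trans (cong₂ (λ b x → ⟦ b ∧ (x ≡ᵇ k) ⟧) isEq (sP-extend π S Rπ RS ok))
  (trans (⟦∧⟧-regroup dc DN c1 c2 c3 CN ic (sP (π , S) + ΣX ≡ᵇ k))
  (trans (cong (λ z → ⟦ v ⟧ * ⟦ z ∧ (sP (π , S) + ΣX ≡ᵇ k) ⟧) (all-∧ AF _ _))
  (⟦∧+≡ᵇ⟧-cong v (validRows (suc j) s a Rπ RS) (sP (π , S)) ΣX (rowsWeight (suc j) s Rπ RS) k hX)))
  where
  AF = toList (allFin r)
  ok = allNonEmpty⇒minsPreserved π Rπ e
  dc = disjointCover (π , S)
  DN = all (λ i → #true (column Rπ i) + #true (column RS i) ≡ᵇ 1) AF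
  c1 = cond1 (π , S)
  c2 = cond2 (π , S)
  c3 = cond3 a (π , S)
  CN = all (λ i → orV (column Rπ i) ∨ inAllowedSlot (a i) (column RS i)) AF
  ic = increasing π
  v = dc ∧ c1 ∧ c2 ∧ c3 ∧ ic
  ΣX = ΣL AF (newElemWeight (labelled (π , S)) (toList Rπ ++ toList RS))
  isEq : isFStirling a (extendSets π Rπ , extendSets S RS) ≡ ((dc ∧ DN) ∧ c1 ∧ c2 ∧ (c3 ∧ CN) ∧ ic)
  isEq = cong₂ _∧_ (disjointCover-extend π S Rπ RS ok) (cong₂ _∧_ (cond1-extend π S Rπ RS ok)
           (cong₂ _∧_ (cond2-extend π S Rπ RS e) (cong₂ _∧_ (cond3-extend a π S Rπ RS) (increasing-extend π Rπ ok))))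
  hX : v ≡ true → validRows (suc j) s a Rπ RS ≡ true → ΣX ≡ rowsWeight (suc j) s Rπ RS
  hX hv hg = ΣL-cong-all AF (λ i → validPlacement (a i) (column Rπ i) (column RS i)) _ _ hg
    (λ i gi → newElemWeight≡placementWeight π S Rπ RS i hinc e (validPlacement⇒placed (a i) (column Rπ i) (column RS i) gi))
    where
    hinc : increasing π ≡ true
    hinc = ∧-true-r {c3} (∧-true-r {c2} (∧-true-r {c1} (∧-true-r {dc} hv)))

-- The new number forms a block of its own

extendSets-∷ʳ : ∀ {n r m} (π : Vec (Sub n r) m) e (R : Vec (Vec Bool r) m) row → extendSets (π ∷ʳ e) (R ∷ʳ row) ≡ extendSets π R ∷ʳ (e ∷ʳ row)
extendSets-∷ʳ [] e [] row = refl
extendSets-∷ʳ (b ∷ π) e (x ∷ R) row = cong (_ ∷_) (extendSets-∷ʳ π e R row)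

minsPreserved-allFalse : ∀ {n r m} (π : Vec (Sub n r) m) → minsPreserved π (replicate m (allFalse r)) ≡ true
minsPreserved-allFalse {r = r} [] = refl
minsPreserved-allFalse {r = r} (b ∷ π) rewrite allV-not-allFalse r | minsPreserved-allFalse π with nonEmpty b
... | true = refl
... | false = refl

firstRow-empty : ∀ n r → firstRow (replicate n (allFalse r)) ≡ nothing
firstRow-empty zero r = refl
firstRow-empty (suc n) r rewrite orV-allFalse r | firstRow-empty n r = refl

singletonBlock : ∀ n r → Sub (suc n) r
singletonBlock n r = replicate n (allFalse r) ∷ʳ allTrue r

firstRow-singletonBlock : ∀ n r → firstRow (singletonBlock n (suc r)) ≡ just (fromℕ n)
firstRow-singletonBlock n r rewrite firstRow-∷ʳ (replicate n (allFalse (suc r))) (allTrue (suc r)) | firstRow-empty n (suc r) = refl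

minNum-singletonBlock : ∀ n r → minNum (singletonBlock n (suc r)) ≡ suc n
minNum-singletonBlock n r rewrite firstRow-singletonBlock n r = cong suc (toℕ-fromℕ n)

cond1Block-singletonBlock : ∀ n r → cond1Block (singletonBlock n (suc r)) ≡ true
cond1Block-singletonBlock n r rewrite firstRow-singletonBlock n r | lookup-∷ʳ-fromℕ (replicate n (allFalse (suc r))) (allTrue (suc r)) = andV-allTrue r

mem-singletonBlock-oldElem : ∀ n r (x : Fin n × Fin r) → mem (singletonBlock n r) (oldElem x) ≡ false
mem-singletonBlock-oldElem n r (m , i) rewrite lookup-∷ʳ-inject₁ (replicate n (allFalse r)) (allTrue r) m | VP.lookup-replicate m (allFalse r) = VP.lookup-replicate i false

mem-singletonBlock-newElem : ∀ n r (i : Fin r) → mem (singletonBlock n r) (newElem {n} i) ≡ true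
mem-singletonBlock-newElem n r i rewrite lookup-∷ʳ-fromℕ (replicate n (allFalse r)) (allTrue r) = VP.lookup-replicate i true

labelOf-skip : ∀ {n r} (xs : List (ℤ × Sub n r)) y zs x → mem (proj₂ y) x ≡ false → labelOf (xs ++ y ∷ zs) x ≡ labelOf (xs ++ zs) x
labelOf-skip [] (l , A) zs x e rewrite e = refl
labelOf-skip ((l , A) ∷ xs) y zs x e rewrite labelOf-skip xs y zs x e = refl

labelOf-hit : ∀ {n r} (xs : List (ℤ × Sub n r)) y zs x → all (λ A → not (mem (proj₂ A) x)) xs ≡ true → mem (proj₂ y) x ≡ true → labelOf (xs ++ y ∷ zs) x ≡ proj₁ y
labelOf-hit [] (l , A) zs x h e rewrite e = refl
labelOf-hit ((l , A) ∷ xs) y zs x h e with mem A x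
... | false = labelOf-hit xs y zs x h e

count-allFalseRows : ∀ {r} m (i : Fin r) → count (λ row → lookup row i) (toList (replicate m (allFalse r))) ≡ 0
count-allFalseRows zero i = refl
count-allFalseRows {r} (suc m) i rewrite VP.lookup-replicate i false = count-allFalseRows m i

increasing-∷ʳ : ∀ {n r m} (xs : Vec (Sub n r) m) y → allV (λ b → minNum b <ᵇ minNum y) xs ≡ true → increasing (xs ∷ʳ y) ≡ increasing xs
increasing-∷ʳ [] y h = refl
increasing-∷ʳ (b ∷ []) y h = trans (∧-identityʳ _) (∧-true-l {minNum b <ᵇ minNum y} {true} h)
increasing-∷ʳ (b ∷ b' ∷ xs) y h = cong ((minNum b <ᵇ minNum b') ∧_) (increasing-∷ʳ (b' ∷ xs) y (∧-true-r {minNum b <ᵇ minNum y} h))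

module NewSingleton {n r' j s : ℕ} (π : Vec (Sub n (suc r')) j) (S : Vec (Sub n (suc r')) s) where
  r : ℕ
  r = suc r'
  emptyRowsπ : Vec (Vec Bool r) j
  emptyRowsπ = replicate j (allFalse r)
  emptyRowsS : Vec (Vec Bool r) s
  emptyRowsS = replicate s (allFalse r)
  πOld : Vec (Sub (suc n) r) j
  πOld = extendSets π emptyRowsπ
  π⁺ : Vec (Sub (suc n) r) (suc j)
  π⁺ = πOld ∷ʳ singletonBlock n r
  S⁺ : Vec (Sub (suc n) r) s
  S⁺ = extendSets S emptyRowsS
  copies : List (Fin r)
  copies = toList (allFin r)
  oldBlockEntries : List (ℤ × Sub (suc n) r)
  oldBlockEntries = map blockEntry (toList πOld)
  slotEntries : List (ℤ × Sub (suc n) r)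
  slotEntries = map (slotEntry S⁺) (toList (allFin s))
  Lp : List (ℤ × Sub n r)
  Lp = labelled (π , S)
  rows : List (Vec Bool r)
  rows = toList emptyRowsπ ++ toList emptyRowsS
  ok : minsPreserved π emptyRowsπ ≡ true
  ok = minsPreserved-allFalse {n} {r} π
  len : length Lp ≡ length rows
  len = length-labelled π S emptyRowsπ emptyRowsS

  labelled-π⁺ : labelled (π⁺ , S⁺) ≡ oldBlockEntries ++ blockEntry (singletonBlock n r) ∷ slotEntries
  labelled-π⁺ = trans (cong (λ z → map blockEntry z ++ slotEntries) (VP.toList-∷ʳ (singletonBlock n r) πOld))
        (trans (cong (_++ slotEntries) (LP.map-++ blockEntry (toList πOld) (singletonBlock n r ∷ [])))
        (LP.++-assoc oldBlockEntries (blockEntry (singletonBlock n r) ∷ []) slotEntries))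

  labelled-old : oldBlockEntries ++ slotEntries ≡ appendRows Lp rows
  labelled-old = labelled-extend π S emptyRowsπ emptyRowsS ok

  disjointCover-π⁺ : disjointCover (π⁺ , S⁺) ≡ disjointCover (π , S)
  disjointCover-π⁺ =
    trans (cong (λ L → all (λ x → count (λ A → mem (proj₂ A) x) L ≡ᵇ 1) (elems (suc n) r)) labelled-π⁺)
    (trans (cong (all _) (elems-suc n r))
    (trans (all-++ _ (map oldElem (elems n r)) _)
    (trans (cong₂ _∧_
      (trans (all-map _ oldElem (elems n r)) (all-cong (elems n r) (λ x → cong (_≡ᵇ 1)
         (trans (count-insert (λ A → mem (proj₂ A) (oldElem x)) oldBlockEntries (blockEntry (singletonBlock n r)) slotEntries)
         (trans (cong₂ _+_ (cong ⟦_⟧ (mem-singletonBlock-oldElem n r x)) (cong (count (λ A → mem (proj₂ A) (oldElem x))) labelled-old))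
         (count-mem-appendRows-old Lp rows len x))))))
      (trans (all-map _ newElem copies) (trans (all-cong copies (λ i → cong (_≡ᵇ 1)
         (trans (count-insert (λ A → mem (proj₂ A) (newElem {n} i)) oldBlockEntries (blockEntry (singletonBlock n r)) slotEntries)
         (trans (cong₂ _+_ (cong ⟦_⟧ (mem-singletonBlock-newElem n r i)) (cong (count (λ A → mem (proj₂ A) (newElem {n} i))) labelled-old))
         (cong suc (trans (count-mem-appendRows-new Lp rows len i) (trans (count-++ _ (toList emptyRowsπ) (toList emptyRowsS)) (cong₂ _+_ (count-allFalseRows j i) (count-allFalseRows s i))))))))) (all-const-true copies))))
    (∧-identityʳ _))))

  cond1-π⁺ : cond1 (π⁺ , S⁺) ≡ cond1 (π , S)
  cond1-π⁺ = trans (cong (all cond1Block) (VP.toList-∷ʳ (singletonBlock n r) πOld))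
        (trans (all-++ cond1Block (toList πOld) (singletonBlock n r ∷ []))
        (trans (cong₂ _∧_ (cond1-extend π S emptyRowsπ emptyRowsS ok) (cong (_∧ true) (cond1Block-singletonBlock n r')))
        (∧-identityʳ _)))

  anyFirstRow-extend : ∀ {n'} {m} (π : Vec (Sub (suc n') r) m) → any (λ b → andV (lookup b zero)) (toList (extendSets π (replicate m (allFalse r)))) ≡ any (λ b → andV (lookup b zero)) (toList π)
  anyFirstRow-extend [] = refl
  anyFirstRow-extend ((x ∷ b) ∷ π) = cong (_ ∨_) (anyFirstRow-extend π)

  cond2-π⁺ : cond2 (π⁺ , S⁺) ≡ cond2 (π , S)
  cond2-π⁺ = go n π S
    where
    go : ∀ n (π : Vec (Sub n r) j) (S : Vec (Sub n r) s) → cond2 (extendSets π emptyRowsπ ∷ʳ singletonBlock n r , extendSets S emptyRowsS) ≡ cond2 (π , S)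
    go zero π S = trans (cong (any (λ b → andV (lookup b zero))) (VP.toList-∷ʳ (singletonBlock zero r) (extendSets π emptyRowsπ)))
                  (trans (any-++ (λ b → andV (lookup b zero)) (toList (extendSets π emptyRowsπ)) (singletonBlock zero r ∷ []))
                  (trans (cong (any (λ b → andV (lookup b zero)) (toList (extendSets π emptyRowsπ)) ∨_) (cong (_∨ false) (andV-allTrue r))) (∨-zeroʳ _)))
    go (suc n) π S = trans (cong (any _) (VP.toList-∷ʳ (singletonBlock (suc n) r) (extendSets π emptyRowsπ)))
                     (trans (any-++ _ (toList (extendSets π emptyRowsπ)) (singletonBlock (suc n) r ∷ []))
                     (trans (∨-identityʳ _) (anyFirstRow-extend π)))

  anyBlock-π⁺-oldElem : ∀ x → any (λ b → mem b (oldElem x)) (toList π⁺) ≡ any (λ b → mem b x) (toList π)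
  anyBlock-π⁺-oldElem x = trans (cong (any _) (VP.toList-∷ʳ (singletonBlock n r) πOld))
    (trans (any-++ _ (toList πOld) (singletonBlock n r ∷ []))
    (trans (cong₂ _∨_ (anyBlock-oldElem π emptyRowsπ x) (cong (_∨ false) (mem-singletonBlock-oldElem n r x))) (∨-identityʳ _)))

  anyBlock-π⁺-newElem : ∀ i → any (λ b → mem b (newElem {n} i)) (toList π⁺) ≡ true
  anyBlock-π⁺-newElem i = trans (cong (any _) (VP.toList-∷ʳ (singletonBlock n r) πOld))
    (trans (any-++ _ (toList πOld) (singletonBlock n r ∷ []))
    (trans (cong (any (λ b → mem b (newElem {n} i)) (toList πOld) ∨_) (cong (_∨ false) (mem-singletonBlock-newElem n r i))) (∨-zeroʳ _)))

  cond3-π⁺ : ∀ (a : Fin r → ℕ) → cond3 a (π⁺ , S⁺) ≡ cond3 a (π , S)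
  cond3-π⁺ a =
    trans (cong (all _) (elems-suc n r))
    (trans (all-++ _ (map oldElem (elems n r)) _)
    (trans (cong₂ _∧_ (trans (all-map _ oldElem (elems n r)) (all-cong (elems n r) (λ x →
                   cong₂ _∨_ (anyBlock-π⁺-oldElem x) (any-cong (toList (allFin s)) (λ p → cong (_∧ _) (mem-slot-oldElem S emptyRowsS p x))))))
               (trans (all-map _ newElem copies) (trans (all-cong copies (λ i → cong (λ z → z ∨ any (λ p → mem (lookup S⁺ p) (newElem {n} i) ∧ (suc (toℕ p) <ᵇ suc (a i))) (toList (allFin s))) (anyBlock-π⁺-newElem i))) (all-const-true copies))))
    (∧-identityʳ _)))

  increasing-π⁺ : increasing π⁺ ≡ increasing π
  increasing-π⁺ = trans (increasing-∷ʳ πOld (singletonBlock n r) (go π))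
         (increasing-extend π emptyRowsπ ok)
    where
    go : ∀ {m} (π : Vec (Sub n r) m) → allV (λ b → minNum b <ᵇ minNum (singletonBlock n r)) (extendSets π (replicate m (allFalse r))) ≡ true
    go [] = refl
    go (b ∷ π) = cong₂ _∧_ (trans (cong₂ _<ᵇ_ (minNum-∷ʳ b (allFalse r) (trans (cong (nonEmpty b ∨_) (allV-not-allFalse r)) (∨-zeroʳ (nonEmpty b)))) (minNum-singletonBlock n r')) (minNum≤n b)) (go π)

  entries⁺ : List (ℤ × Sub (suc n) r)
  entries⁺ = oldBlockEntries ++ blockEntry (singletonBlock n r) ∷ slotEntries

  sPSummand-oldElem : ∀ x → sPSummand {n} {r} (labelled (π⁺ , S⁺)) (oldElem x) ≡ sPSummand {n} {r} Lp x
  sPSummand-oldElem (m , i) =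
    trans (cong (λ L → sPSummand {n} {r} L (oldElem (m , i))) labelled-π⁺)
    (trans (cong (λ lab → count (λ A → Q lab (proj₁ A)) entries⁺) labEq)
    (trans (count-insert (λ A → Q (labelOf Lp x) (proj₁ A)) oldBlockEntries (blockEntry (singletonBlock n r)) slotEntries)
    (trans (cong₂ _+_ (cong ⟦_⟧ qB) (cong (count (λ A → Q (labelOf Lp x) (proj₁ A))) labelled-old))
    (trans (count-label-appendRows (Q (labelOf Lp x)) Lp rows len)
    (cong (λ t → count (λ A → (labelOf Lp x <ℤᵇ proj₁ A) ∧ (proj₁ A <ℤᵇ (+ suc t))) Lp) (toℕ-inject₁ m))))))
    where
    x = (m , i)
    Q : ℤ → ℤ → Bool
    Q lab l = (lab <ℤᵇ l) ∧ (l <ℤᵇ (+ suc (toℕ (inject₁ m))))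
    labEq : labelOf entries⁺ (oldElem x) ≡ labelOf Lp x
    labEq = trans (labelOf-skip oldBlockEntries (blockEntry (singletonBlock n r)) slotEntries (oldElem x) (mem-singletonBlock-oldElem n r x))
            (trans (cong (λ L → labelOf L (oldElem x)) labelled-old) (labelOf-appendRows-old Lp rows len x))
    qB : Q (labelOf Lp x) (+ minNum (singletonBlock n r)) ≡ false
    qB rewrite minNum-singletonBlock n r' | toℕ-inject₁ m | <ᵇ-asym (toℕ m) n (toℕ<ᵇn m) = ∧-zeroʳ _

  oldBlocks-∌newElem : ∀ {m} (π : Vec (Sub n r) m) i → all (λ A → not (mem (proj₂ A) (newElem {n} i))) (map blockEntry (toList (extendSets π (replicate m (allFalse r))))) ≡ true
  oldBlocks-∌newElem [] i = refl
  oldBlocks-∌newElem (b ∷ π) i rewrite lookup-∷ʳ-fromℕ b (allFalse r) | VP.lookup-replicate i false = oldBlocks-∌newElem π i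

  sPSummand-newElem : ∀ i → sPSummand {n} {r} (labelled (π⁺ , S⁺)) (newElem {n} i) ≡ 0
  sPSummand-newElem i =
    trans (cong (λ L → sPSummand {n} {r} L (newElem {n} i)) labelled-π⁺)
    (trans (cong (λ lab → count (λ A → Q lab (proj₁ A)) entries⁺) (trans (labelOf-hit oldBlockEntries (blockEntry (singletonBlock n r)) slotEntries (newElem {n} i) (oldBlocks-∌newElem π i) (mem-singletonBlock-newElem n r i)) (cong +_ (minNum-singletonBlock n r'))))
    (trans (count-insert (λ A → Q (+ suc n) (proj₁ A)) oldBlockEntries (blockEntry (singletonBlock n r)) slotEntries)
    (trans (cong₂ _+_ (cong ⟦_⟧ qB) (count-++ (λ A → Q (+ suc n) (proj₁ A)) oldBlockEntries slotEntries))
    (cong₂ _+_ (trans (count-map _ blockEntry (toList πOld)) (count-none _ (toList πOld) qA))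
               (trans (count-map _ (slotEntry S⁺) (toList (allFin s))) (count-none _ (toList (allFin s)) (λ p → cong (_∧ ((- (+ toℕ p)) <ℤᵇ (+ suc (toℕ (fromℕ n))))) (+≮- (suc n) (toℕ p)))))))))
    where
    Q : ℤ → ℤ → Bool
    Q lab l = (lab <ℤᵇ l) ∧ (l <ℤᵇ (+ suc (toℕ (fromℕ n))))
    qB : Q (+ suc n) (+ minNum (singletonBlock n r)) ≡ false
    qB rewrite minNum-singletonBlock n r' | <ᵇ-irr n = refl
    qA : ∀ (b : Sub (suc n) r) → Q (+ suc n) (+ minNum b) ≡ false
    qA b rewrite <ᵇ-suc-asym (minNum b) (suc n) (minNum≤n b) = refl

  sP-π⁺ : sP (π⁺ , S⁺) ≡ sP (π , S)
  sP-π⁺ =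
    trans (sum-map≡ΣL (sPSummand {n} {r} L) (elems (suc n) r))
    (trans (cong (λ z → ΣL z (sPSummand {n} {r} L)) (elems-suc n r))
    (trans (ΣL-++ (map oldElem (elems n r)) _ (sPSummand {n} {r} L))
    (trans (cong₂ _+_ (trans (ΣL-map oldElem (elems n r) (sPSummand {n} {r} L)) (trans (ΣL-cong (elems n r) sPSummand-oldElem) (sym (sum-map≡ΣL (sPSummand {n} {r} Lp) (elems n r)))))
                      (trans (ΣL-map newElem copies (sPSummand {n} {r} L)) (trans (ΣL-cong copies sPSummand-newElem) (ΣL-zero copies))))
    (+-identityʳ _))))
    where
    L = labelled (π⁺ , S⁺)

  ⟦stirling⟧-newSingleton : ∀ (a : Fin r → ℕ) k → ⟦ isFStirling a (π⁺ , S⁺) ∧ (sP (π⁺ , S⁺) ≡ᵇ k) ⟧ ≡ ⟦ isFStirling a (π , S) ∧ (sP (π , S) ≡ᵇ k) ⟧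
  ⟦stirling⟧-newSingleton a k = cong₂ (λ b x → ⟦ b ∧ (x ≡ᵇ k) ⟧)
    (cong₂ _∧_ disjointCover-π⁺ (cong₂ _∧_ cond1-π⁺ (cong₂ _∧_ cond2-π⁺ (cong₂ _∧_ (cond3-π⁺ a) increasing-π⁺)))) sP-π⁺

-- No other extensions are f-Stirling partitions

count-blocks-newElem : ∀ {n r m} (π : Vec (Sub n r) m) (R : Vec (Vec Bool r) m) i →
  count (λ A → mem (proj₂ A) (newElem {n} i)) (map blockEntry (toList (extendSets π R))) ≡ #true (column R i)
count-blocks-newElem [] [] i = refl
count-blocks-newElem {n} (b ∷ π) (row ∷ R) i = trans (count≡ΣL _ (map blockEntry (toList (extendSets (b ∷ π) (row ∷ R)))))
  (cong₂ _+_ (cong (λ z → ⟦ lookup z i ⟧) (lookup-∷ʳ-fromℕ b row)) (trans (sym (count≡ΣL _ (map blockEntry (toList (extendSets π R))))) (count-blocks-newElem π R i)))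

disjointCover⇒newColumns : ∀ {n r J s} (π : Vec (Sub n r) J) (S : Vec (Sub n r) s) (Rπ : Vec (Vec Bool r) J) (RS : Vec (Vec Bool r) s) →
  disjointCover (extendSets π Rπ , extendSets S RS) ≡ true → ∀ i → #true (column Rπ i) + #true (column RS i) ≡ 1
disjointCover⇒newColumns {n} {r} {J} {s} π S Rπ RS h i = ≡ᵇ⇒≡ _ 1 (subst T (sym q) _)
  where
  P = (extendSets π Rπ , extendSets S RS)
  h2 : all (λ x → count (λ A → mem (proj₂ A) x) (labelled P) ≡ᵇ 1) (map oldElem (elems n r) ++ map (newElem {n}) (toList (allFin r))) ≡ true
  h2 = trans (cong (all _) (sym (elems-suc n r))) h
  h3 : all (λ i → count (λ A → mem (proj₂ A) (newElem {n} i)) (labelled P) ≡ᵇ 1) (toList (allFin r)) ≡ true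
  h3 = trans (sym (all-map _ newElem (toList (allFin r)))) (∧-true-r {all _ (map oldElem (elems n r))} (trans (sym (all-++ _ (map oldElem (elems n r)) _)) h2))
  cEq : count (λ A → mem (proj₂ A) (newElem {n} i)) (labelled P) ≡ #true (column Rπ i) + #true (column RS i)
  cEq = trans (count-++ _ (map blockEntry (toList (extendSets π Rπ))) (map (slotEntry (extendSets S RS)) (toList (allFin s))))
        (cong₂ _+_ (count-blocks-newElem π Rπ i)
          (trans (count-map _ (slotEntry (extendSets S RS)) (toList (allFin s)))
          (trans (count-cong (toList (allFin s)) (λ p → mem-slot-newElem S RS p i)) (count-lookup≡#true (column RS i)))))
  q : (#true (column Rπ i) + #true (column RS i) ≡ᵇ 1) ≡ true
  q = trans (cong (_≡ᵇ 1) (sym cEq)) (all-allFin⇒ _ h3 i)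

strictlyIncreasing-∷ʳ⇒below : ∀ {m} (ms : Vec ℕ m) z → strictlyIncreasing (ms ∷ʳ z) ≡ true → allV (λ x → x <ᵇ z) ms ≡ true
strictlyIncreasing-∷ʳ⇒below [] z h = refl
strictlyIncreasing-∷ʳ⇒below (x ∷ ms) z h = cong₂ _∧_
  (∧-true-r {allV (λ y → x <ᵇ y) ms} (trans (sym (allV-snoc (λ y → x <ᵇ y) ms z)) (strictlyIncreasing-head x (ms ∷ʳ z) h)))
  (strictlyIncreasing-∷ʳ⇒below ms z (strictlyIncreasing-tail x (ms ∷ʳ z) h))

increasing-∷ʳ⇒below : ∀ {n r m} (xs : Vec (Sub n r) m) y → increasing (xs ∷ʳ y) ≡ true → allV (λ b → minNum b <ᵇ minNum y) xs ≡ true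
increasing-∷ʳ⇒below xs y h = trans (sym (allV-map (λ x → x <ᵇ minNum y) minNum xs))
  (strictlyIncreasing-∷ʳ⇒below (Vec.map minNum xs) (minNum y) (trans (cong strictlyIncreasing (sym (VP.map-∷ʳ minNum y xs))) (trans (strictlyIncreasing-minNums (xs ∷ʳ y)) h)))

empty-cond1Block⇒minNum : ∀ {n r} (b : Sub n r) rb → nonEmpty b ≡ false → cond1Block (b ∷ʳ rb) ≡ true → minNum (b ∷ʳ rb) ≡ suc n
empty-cond1Block⇒minNum {n} b rb e h rewrite firstRow-∷ʳ b rb with firstRow b
... | nothing with orV rb
...   | true = cong suc (toℕ-fromℕ n)

allNonEmpty-init : ∀ {n r m} (π : Vec (Sub n r) m) (R : Vec (Vec Bool r) m) (Y : Sub (suc n) r) →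
  all cond1Block (toList (extendSets π R)) ≡ true → allV (λ b → minNum b <ᵇ minNum Y) (extendSets π R) ≡ true → allNonEmpty π ≡ true
allNonEmpty-init [] [] Y h1 h2 = refl
allNonEmpty-init {n} (b ∷ π) (rb ∷ R) Y h1 h2 with nonEmpty b in eq
... | true = allNonEmpty-init π R Y (∧-true-r {cond1Block (b ∷ʳ rb)} h1) (∧-true-r {minNum (b ∷ʳ rb) <ᵇ minNum Y} h2)
... | false = ⊥-elim (bot (trans (sym (cong (_<ᵇ minNum Y) (empty-cond1Block⇒minNum b rb eq (∧-true-l {cond1Block (b ∷ʳ rb)} {all cond1Block (toList (extendSets π R))} h1))))
                             (∧-true-l {minNum (b ∷ʳ rb) <ᵇ minNum Y} {allV (λ b → minNum b <ᵇ minNum Y) (extendSets π R)} h2)))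
  where
  bot : (suc n <ᵇ minNum Y) ≡ true → ⊥
  bot h with trans (sym h) (<ᵇ-suc-asym (minNum Y) (suc n) (minNum≤n Y))
  ... | ()

firstRow-nothing⇒allFalseSub : ∀ {n r} (e : Sub n r) → firstRow e ≡ nothing → allV (allV not) e ≡ true
firstRow-nothing⇒allFalseSub [] h = refl
firstRow-nothing⇒allFalseSub (x ∷ e) h with orV x in eq
... | false with firstRow e in eq2
...   | nothing = cong₂ _∧_ (orV-false⇒allV-not x eq) (firstRow-nothing⇒allFalseSub e eq2)

¬nonEmpty⇒firstRow-nothing : ∀ {n r} (e : Sub n r) → nonEmpty e ≡ false → firstRow e ≡ nothing
¬nonEmpty⇒firstRow-nothing e h with firstRow e
... | nothing = refl

empty-cond1Block⇒allTrue : ∀ {n r} (e : Sub n r) row → nonEmpty e ≡ false → cond1Block (e ∷ʳ row) ≡ true → andV row ≡ true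
empty-cond1Block⇒allTrue {n} e row h1 h2 rewrite firstRow-∷ʳ e row | ¬nonEmpty⇒firstRow-nothing e h1 with orV row
... | true = trans (sym (cong andV (lookup-∷ʳ-fromℕ e row))) h2

zeroColumns⇒allFalse : ∀ {r m} (R : Vec (Vec Bool r) m) → (∀ i → #true (column R i) ≡ 0) → allV (allV not) R ≡ true
zeroColumns⇒allFalse [] h = refl
zeroColumns⇒allFalse (row ∷ R) h = cong₂ _∧_ (lookup-false⇒allV-not row (λ i → hd i (h i))) (zeroColumns⇒allFalse R (λ i → tl i (h i)))
  where
  hd : ∀ i → ⟦ lookup row i ⟧ + #true (column R i) ≡ 0 → lookup row i ≡ false
  hd i e with lookup row i
  ... | false = refl
  tl : ∀ i → ⟦ lookup row i ⟧ + #true (column R i) ≡ 0 → #true (column R i) ≡ 0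
  tl i e with lookup row i
  ... | false = e

isNewSingleton : ∀ {n r j s} → Vec (Vec Bool r) j → Vec (Vec Bool r) s → Sub n r → Vec Bool r → Bool
isNewSingleton Rπ RS e row = allV (allV not) Rπ ∧ allV (allV not) RS ∧ allV (allV not) e ∧ allV (λ b → b) row

-- A block of π ∷ʳ e that is empty before n + 1 gets the largest label n + 1, so it is the last
-- block e; by (1) it contains all copies of n + 1, and by disjointness nothing else does.
emptyBlock⇒isNewSingleton : ∀ {n r j s} (a : Fin r → ℕ) (π : Vec (Sub n r) j) (e : Sub n r) (Rπ : Vec (Vec Bool r) j) (row : Vec Bool r)
  (S : Vec (Sub n r) s) (RS : Vec (Vec Bool r) s) →
  allNonEmpty (π ∷ʳ e) ≡ false → isFStirling a (extendSets (π ∷ʳ e) (Rπ ∷ʳ row) , extendSets S RS) ≡ true → isNewSingleton Rπ RS e row ≡ true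
emptyBlock⇒isNewSingleton {n} {r} {j} {s} a π e Rπ row S RS hne h =
  cong₂ _∧_ (zeroColumns⇒allFalse Rπ (λ i → proj₁ (ar i))) (cong₂ _∧_ (zeroColumns⇒allFalse RS (λ i → proj₂ (ar i))) (cong₂ _∧_ empE fullRow))
  where
  P = (extendSets (π ∷ʳ e) (Rπ ∷ʳ row) , extendSets S RS)
  X = extendSets π Rπ
  Y = e ∷ʳ row
  hdc : disjointCover P ≡ true
  hdc = ∧-true-l {disjointCover P} h
  h1 = ∧-true-r {disjointCover P} h
  hc1 : cond1 P ≡ true
  hc1 = ∧-true-l {cond1 P} h1
  h2 = ∧-true-r {cond1 P} h1
  h3 = ∧-true-r {cond2 P} h2
  hinc : increasing (proj₁ P) ≡ true
  hinc = ∧-true-r {cond3 a P} h3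
  XY : proj₁ P ≡ X ∷ʳ Y
  XY = extendSets-∷ʳ π e Rπ row
  hc1' : (all cond1Block (toList X) ∧ (cond1Block Y ∧ true)) ≡ true
  hc1' = trans (sym (all-++ cond1Block (toList X) (Y ∷ []))) (trans (cong (all cond1Block) (sym (VP.toList-∷ʳ Y X))) (trans (cong (λ z → all cond1Block (toList z)) (sym XY)) hc1))
  c1X = ∧-true-l {all cond1Block (toList X)} hc1'
  c1Y : cond1Block Y ≡ true
  c1Y = ∧-true-l {cond1Block Y} {true} (∧-true-r {all cond1Block (toList X)} hc1')
  lt = increasing-∷ʳ⇒below X Y (trans (cong increasing (sym XY)) hinc)
  neπ : allNonEmpty π ≡ true
  neπ = allNonEmpty-init π Rπ Y c1X lt
  neE : nonEmpty e ≡ false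
  neE with nonEmpty e in eq
  ... | false = refl
  ... | true with trans (sym hne) (trans (cong (all nonEmpty) (VP.toList-∷ʳ e π)) (trans (all-++ nonEmpty (toList π) (e ∷ [])) (cong₂ _∧_ neπ (cong (_∧ true) eq))))
  ...   | ()
  fullRow : allV (λ b → b) row ≡ true
  fullRow = trans (sym (andV≡allV row)) (empty-cond1Block⇒allTrue e row neE c1Y)
  empE : allV (allV not) e ≡ true
  empE = firstRow-nothing⇒allFalseSub e (¬nonEmpty⇒firstRow-nothing e neE)
  ar : ∀ i → #true (column Rπ i) ≡ 0 × #true (column RS i) ≡ 0
  ar i = +1+≡1 (#true (column Rπ i)) (#true (column RS i))
    (trans (cong (λ z → z + #true (column RS i)) (sym (trans (cong #true (VP.map-∷ʳ (λ rw → lookup rw i) row Rπ))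
             (trans (#true-∷ʳ (column Rπ i) (lookup row i)) (cong (λ z → #true (column Rπ i) + ⟦ z ⟧) (allV-id⇒lookup row fullRow i))))))
           (disjointCover⇒newColumns (π ∷ʳ e) S (Rπ ∷ʳ row) RS hdc i))

⟦stirling⟧ : ∀ {n r j s} → (Fin r → ℕ) → ℕ → Cand n r j s → ℕ
⟦stirling⟧ a k P = ⟦ isFStirling a P ∧ (sP P ≡ᵇ k) ⟧

allFalseSub⇒firstRow-nothing : ∀ {n r} (e : Sub n r) → allV (allV not) e ≡ true → firstRow e ≡ nothing
allFalseSub⇒firstRow-nothing [] h = refl
allFalseSub⇒firstRow-nothing (x ∷ e) h rewrite allV-not⇒orV x (∧-true-l {allV not x} {allV (allV not) e} h) | allFalseSub⇒firstRow-nothing e (∧-true-r {allV not x} h) = refl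

allNonEmpty-∷ʳ : ∀ {n r m} (π : Vec (Sub n r) m) e → allNonEmpty (π ∷ʳ e) ≡ allNonEmpty π ∧ (nonEmpty e ∧ true)
allNonEmpty-∷ʳ π e = trans (cong (all nonEmpty) (VP.toList-∷ʳ e π)) (all-++ nonEmpty (toList π) (e ∷ []))

isNewSingleton⇒empty : ∀ {n r j s} (Rπ : Vec (Vec Bool r) j) (RS : Vec (Vec Bool r) s) (e : Sub n r) row → isNewSingleton Rπ RS e row ≡ true → nonEmpty e ≡ false
isNewSingleton⇒empty Rπ RS e row eq rewrite allFalseSub⇒firstRow-nothing e (∧-true-l {allV (allV not) e} {allV (λ b → b) row} (∧-true-r {allV (allV not) RS} (∧-true-r {allV (allV not) Rπ} eq))) = refl

isNewSingleton-allNonEmpty : ∀ {n r j s} (π : Vec (Sub n r) j) e (Rπ : Vec (Vec Bool r) j) (RS : Vec (Vec Bool r) s) row c →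
  allNonEmpty (π ∷ʳ e) ≡ true → ⟦ isNewSingleton Rπ RS e row ⟧ * c ≡ 0
isNewSingleton-allNonEmpty π e Rπ RS row c hne with isNewSingleton Rπ RS e row in eq
... | false = refl
... | true = ⊥-elim (bot (allNonEmpty π) (trans (sym hne) (trans (allNonEmpty-∷ʳ π e) (cong (λ z → allNonEmpty π ∧ (z ∧ true)) (isNewSingleton⇒empty Rπ RS e row eq)))))
  where
  bot : ∀ b → true ≡ b ∧ false → ⊥
  bot true ()
  bot false ()

emptyBlock⇒¬isFStirling : ∀ {n r j s} (a : Fin r → ℕ) (π : Vec (Sub n r) j) e (S : Vec (Sub n r) s) → allNonEmpty (π ∷ʳ e) ≡ false → isFStirling a (π ∷ʳ e , S) ≡ false
emptyBlock⇒¬isFStirling a π e S h with cond1 (π ∷ʳ e , S) in eq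
... | true = ⊥-elim (bot (trans (sym (cond1⇒allNonEmpty (π ∷ʳ e) eq)) h))
  where
  bot : true ≡ false → ⊥
  bot ()
... | false = ∧-zeroʳ (disjointCover (π ∷ʳ e , S))

⟦stirling⟧-isNewSingleton : ∀ {n r' j s} (a : Fin (suc r') → ℕ) k (π : Vec (Sub n (suc r')) j) (e : Sub n (suc r')) (Rπ : Vec (Vec Bool (suc r')) j) (row : Vec Bool (suc r'))
  (S : Vec (Sub n (suc r')) s) (RS : Vec (Vec Bool (suc r')) s) → isNewSingleton Rπ RS e row ≡ true →
  ⟦stirling⟧ a k (extendSets (π ∷ʳ e) (Rπ ∷ʳ row) , extendSets S RS) ≡ ⟦stirling⟧ a k (π , S)
⟦stirling⟧-isNewSingleton {n} {r'} {j} {s} a k π e Rπ row S RS h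
  rewrite allV-allV-not⇒allFalse Rπ (∧-true-l {allV (allV not) Rπ} {allV (allV not) RS ∧ allV (allV not) e ∧ allV (λ b → b) row} h)
        | allV-allV-not⇒allFalse RS (∧-true-l {allV (allV not) RS} {allV (allV not) e ∧ allV (λ b → b) row} (∧-true-r {allV (allV not) Rπ} h))
        | allV-allV-not⇒allFalse e (∧-true-l {allV (allV not) e} {allV (λ b → b) row} (∧-true-r {allV (allV not) RS} (∧-true-r {allV (allV not) Rπ} h)))
        | allV-id⇒allTrue row (∧-true-r {allV (allV not) e} (∧-true-r {allV (allV not) RS} (∧-true-r {allV (allV not) Rπ} h)))
        | extendSets-∷ʳ π (replicate n (allFalse (suc r'))) (replicate j (allFalse (suc r'))) (allTrue (suc r'))
  = NewSingleton.⟦stirling⟧-newSingleton π S a k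

-- Cutting off the copies of n + 1, a partition of order (n + 1, j + 1) comes either from one of
-- order (n, j) by adding the block {(n+1)₁, …, (n+1)ᵣ}, or from one of order (n, j + 1) by
-- placing every copy validly.
⟦stirling⟧-extend : ∀ {n r' j s} (a : Fin (suc r') → ℕ) k (π : Vec (Sub n (suc r')) j) (e : Sub n (suc r')) (Rπ : Vec (Vec Bool (suc r')) j) (row : Vec Bool (suc r'))
  (S : Vec (Sub n (suc r')) s) (RS : Vec (Vec Bool (suc r')) s) →
  ⟦stirling⟧ a k (extendSets (π ∷ʳ e) (Rπ ∷ʳ row) , extendSets S RS) ≡
  ⟦ isNewSingleton Rπ RS e row ⟧ * ⟦stirling⟧ a k (π , S) +
  ⟦ isFStirling a (π ∷ʳ e , S) ⟧ * ⟦ validRows (suc j) s a (Rπ ∷ʳ row) RS ∧ (sP (π ∷ʳ e , S) + rowsWeight (suc j) s (Rπ ∷ʳ row) RS ≡ᵇ k) ⟧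
⟦stirling⟧-extend {n} {r'} {j} {s} a k π e Rπ row S RS with allNonEmpty (π ∷ʳ e) in hne
... | true = trans (⟦stirling⟧-extend-nonEmpty a k (π ∷ʳ e) S (Rπ ∷ʳ row) RS hne) (cong (_+ T2) (sym (isNewSingleton-allNonEmpty π e Rπ RS row (⟦stirling⟧ a k (π , S)) hne)))
  where
  T2 = ⟦ isFStirling a (π ∷ʳ e , S) ⟧ * ⟦ validRows (suc j) s a (Rπ ∷ʳ row) RS ∧ (sP (π ∷ʳ e , S) + rowsWeight (suc j) s (Rπ ∷ʳ row) RS ≡ᵇ k) ⟧
... | false rewrite emptyBlock⇒¬isFStirling a π e S hne with isNewSingleton Rπ RS e row in eq
...   | true = trans (⟦stirling⟧-isNewSingleton a k π e Rπ row S RS eq) (sym (trans (+-identityʳ _) (+-identityʳ _)))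
...   | false with isFStirling a (extendSets (π ∷ʳ e) (Rπ ∷ʳ row) , extendSets S RS) in hv
...     | false = refl
...     | true = ⊥-elim (bot (trans (sym eq) (emptyBlock⇒isNewSingleton a π e Rπ row S RS hne hv)))
  where
  bot : false ≡ true → ⊥
  bot ()

module Recurrence (r' : ℕ) (a : Fin (suc r') → ℕ) (le : ∀ i → a i ≤ aLast (suc r') a) where
  r : ℕ
  r = suc r'
  s : ℕ
  s = aLast r a
  rows : List (Vec Bool r)
  rows = vecsOf bools r

  stirlingSum : ℕ → ℕ → ℕ → ℕ
  stirlingSum n j k = ΣL (vecsOf (allSubs n r) j) (λ π → ΣL (vecsOf (allSubs n r) s) (λ S → ⟦stirling⟧ a k (π , S)))

  stirlingCount≡stirlingSum : ∀ n j k → stirlingCount r a n j k ≡ stirlingSum n j k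
  stirlingCount≡stirlingSum n j k = trans (count≡ΣL _ (allCands n r j s))
    (trans (ΣL-concatMap _ (vecsOf (allSubs n r) j) _)
    (ΣL-cong (vecsOf (allSubs n r) j) (λ π → ΣL-map (λ S → π , S) (vecsOf (allSubs n r) s) _)))

  qWeight : ℕ → ℕ → ℕ
  qWeight j = prodP (λ i → qint (suc j + a i))

  module ExtendNonEmpty (n j k : ℕ) where
    J : ℕ
    J = suc j
    subs : List (Sub n r)
    subs = allSubs n r
    nonEmptyTerm : Vec (Sub n r) J → Vec (Vec Bool r) J → ℕ
    nonEmptyTerm π' Rπ = ΣL (vecsOf subs s) (λ S' → ΣL (vecsOf rows s) (λ RS →
       ⟦ isFStirling a (π' , S') ⟧ * ⟦ validRows J s a Rπ RS ∧ (sP (π' , S') + rowsWeight J s Rπ RS ≡ᵇ k) ⟧))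

    ΣL-rows-⟦+≡ᵇ⟧ : ∀ x → ΣL (vecsOf rows J) (λ Rπ → ΣL (vecsOf rows s) (λ RS → ⟦ validRows J s a Rπ RS ∧ (x + rowsWeight J s Rπ RS ≡ᵇ k) ⟧))
                 ≡ ⟦ x <ᵇ suc k ⟧ * qWeight j (k ∸ x)
    ΣL-rows-⟦+≡ᵇ⟧ x = trans (ΣL-cong (vecsOf rows J) (λ Rπ → trans (ΣL-cong (vecsOf rows s) (λ RS → ⟦∧+≡ᵇ⟧ (validRows J s a Rπ RS) x (rowsWeight J s Rπ RS) k))
                        (ΣL-*ˡ (vecsOf rows s) ⟦ x <ᵇ suc k ⟧ _)))
              (trans (ΣL-*ˡ (vecsOf rows J) ⟦ x <ᵇ suc k ⟧ _) (cong (⟦ x <ᵇ suc k ⟧ *_) (ΣL-validRows≡prodP J s r a (λ i → le i) (k ∸ x))))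

    ⟦∧⟧*-sumLe-delta : ∀ v x → ⟦ v ⟧ * (⟦ x <ᵇ suc k ⟧ * qWeight j (k ∸ x)) ≡ sumLe (λ t → ⟦ v ∧ (x ≡ᵇ t) ⟧ * qWeight j (k ∸ t)) k
    ⟦∧⟧*-sumLe-delta v x = trans (cong (⟦ v ⟧ *_) (sym (sumLe-delta x k (λ t → qWeight j (k ∸ t)))))
             (trans (sym (sumLe-*ˡ k ⟦ v ⟧ (λ t → ⟦ x ≡ᵇ t ⟧ * qWeight j (k ∸ t))))
             (sumLe-cong k (λ t → trans (sym (*-assoc ⟦ v ⟧ ⟦ x ≡ᵇ t ⟧ (qWeight j (k ∸ t)))) (cong (_* qWeight j (k ∸ t)) (sym (⟦∧⟧ v (x ≡ᵇ t)))))))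

    ΣL-extendNonEmpty : ΣL (vecsOf subs J) (λ π' → ΣL (vecsOf rows J) (λ Rπ → nonEmptyTerm π' Rπ)) ≡ sumLe (λ t → stirlingSum n J t * qWeight j (k ∸ t)) k
    ΣL-extendNonEmpty = trans (ΣL-cong (vecsOf subs J) (λ π' →
               trans (ΣL-swap (vecsOf rows J) (vecsOf subs s) _)
               (ΣL-cong (vecsOf subs s) (λ S' →
                  trans (ΣL-cong (vecsOf rows J) (λ Rπ → ΣL-*ˡ (vecsOf rows s) ⟦ isFStirling a (π' , S') ⟧ _))
                  (trans (ΣL-*ˡ (vecsOf rows J) ⟦ isFStirling a (π' , S') ⟧ _)
                  (trans (cong (⟦ isFStirling a (π' , S') ⟧ *_) (ΣL-rows-⟦+≡ᵇ⟧ (sP (π' , S'))))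
                  (⟦∧⟧*-sumLe-delta (isFStirling a (π' , S')) (sP (π' , S')))))))))
         (trans (ΣL-cong (vecsOf subs J) (λ π' → ΣL-sumLe (vecsOf subs s) k _))
         (trans (ΣL-sumLe (vecsOf subs J) k _)
         (sumLe-cong k (λ t → trans (ΣL-cong (vecsOf subs J) (λ π' → ΣL-*ʳ (vecsOf subs s) (qWeight j (k ∸ t)) _))
                                   (ΣL-*ʳ (vecsOf subs J) (qWeight j (k ∸ t)) _)))))

  module ExtendSingleton (n j k : ℕ) where
    subs : List (Sub n r)
    subs = allSubs n r
    ΣL-extendSingleton : ΣL (vecsOf subs j) (λ π → ΣL subs (λ e → ΣL (vecsOf rows j) (λ Rπ → ΣL rows (λ row →
           ΣL (vecsOf subs s) (λ S → ΣL (vecsOf rows s) (λ RS → ⟦ isNewSingleton Rπ RS e row ⟧ * ⟦stirling⟧ a k (π , S)))))))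
         ≡ stirlingSum n j k
    ΣL-extendSingleton = ΣL-cong (vecsOf subs j) (λ π →
      trans (ΣL-cong subs (λ e → trans (ΣL-cong (vecsOf rows j) (λ Rπ → trans (ΣL-cong rows (λ row →
               trans (ΣL-cong (vecsOf subs s) (λ S →
                 trans (ΣL-cong (vecsOf rows s) (λ RS → ⟦∧⟧-rearrange (allV (allV not) Rπ) (allV (allV not) RS) (allV (allV not) e) (allV (λ b → b) row) (⟦stirling⟧ a k (π , S))))
                 (ΣL-unique (vecsOf rows s) (allV (allV not)) _ (unique-emptySub r s))))
               (trans (ΣL-*ˡ (vecsOf subs s) ⟦ allV (allV not) e ⟧ _)
               (cong (⟦ allV (allV not) e ⟧ *_) (trans (ΣL-*ˡ (vecsOf subs s) ⟦ allV (allV not) Rπ ⟧ _)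
               (cong (⟦ allV (allV not) Rπ ⟧ *_) (ΣL-*ˡ (vecsOf subs s) ⟦ allV (λ b → b) row ⟧ _)))))))
             (trans (ΣL-*ˡ rows ⟦ allV (allV not) e ⟧ _)
             (cong (⟦ allV (allV not) e ⟧ *_) (trans (ΣL-*ˡ rows ⟦ allV (allV not) Rπ ⟧ _)
             (cong (⟦ allV (allV not) Rπ ⟧ *_) (ΣL-unique rows (allV (λ b → b)) _ (unique-allTrueRow r))))))))
           (trans (ΣL-*ˡ (vecsOf rows j) ⟦ allV (allV not) e ⟧ _)
           (cong (⟦ allV (allV not) e ⟧ *_) (ΣL-unique (vecsOf rows j) (allV (allV not)) _ (unique-emptySub r j))))))
      (ΣL-unique subs (allV (allV not)) _ (unique-emptySub r n)))

  -- Every set is split into its first n rows and its last row, the row of n + 1.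
  stirlingSum-suc : ∀ n j k → stirlingSum (suc n) (suc j) k ≡ stirlingSum n j k + sumLe (λ t → stirlingSum n (suc j) t * qWeight j (k ∸ t)) k
  stirlingSum-suc n j k =
    trans (ΣL-cong (vecsOf subs' J) (λ π → ΣL-vecsOf-zipWith subs rows subs' _∷ʳ_ (ΣL-vecsOf-∷ʳ rows n) s (λ S → ⟦stirling⟧ a k (π , S))))
    (trans (ΣL-vecsOf-zipWith subs rows subs' _∷ʳ_ (ΣL-vecsOf-∷ʳ rows n) J extendedSum)
    (trans (ΣL-vecsOf-∷ʳ subs j (λ π' → ΣL (vecsOf rows J) (extendedSumRows π')))
    (trans (ΣL-cong (vecsOf subs j) (λ π'' → ΣL-cong subs (λ e → ΣL-vecsOf-∷ʳ rows j (extendedSumRows (π'' ∷ʳ e)))))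
    (trans (ΣL-+-cong (vecsOf subs j) (λ π'' → ΣL-+-cong subs (λ e → ΣL-+-cong (vecsOf rows j) (λ Rπ → ΣL-+-cong rows (λ row →
              ΣL-+-cong (vecsOf subs s) (λ S → ΣL-+-cong (vecsOf rows s) (λ RS → ⟦stirling⟧-extend a k π'' e Rπ row S RS)))))))
    (cong₂ _+_ (ExtendSingleton.ΣL-extendSingleton n j k)
      (trans (ΣL-cong (vecsOf subs j) (λ π'' → ΣL-cong subs (λ e → sym (ΣL-vecsOf-∷ʳ rows j (ExtendNonEmpty.nonEmptyTerm n j k (π'' ∷ʳ e))))))
      (trans (sym (ΣL-vecsOf-∷ʳ subs j (λ π' → ΣL (vecsOf rows J) (ExtendNonEmpty.nonEmptyTerm n j k π'))))
      (ExtendNonEmpty.ΣL-extendNonEmpty n j k))))))))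
    where
    J : ℕ
    J = suc j
    subs : List (Sub n r)
    subs = allSubs n r
    subs' : List (Sub (suc n) r)
    subs' = allSubs (suc n) r
    extendedSum : Vec (Sub (suc n) r) J → ℕ
    extendedSum π = ΣL (vecsOf subs s) (λ S' → ΣL (vecsOf rows s) (λ RS → ⟦stirling⟧ a k (π , extendSets S' RS)))
    extendedSumRows : Vec (Sub n r) J → Vec (Vec Bool r) J → ℕ
    extendedSumRows π' Rπ = extendedSum (extendSets π' Rπ)

  stirlingSum-vanishes : ∀ n j k → (∀ π S → ⟦stirling⟧ a k (π , S) ≡ 0) → stirlingSum n j k ≡ 0
  stirlingSum-vanishes n j k h =
    trans (ΣL-cong (vecsOf (allSubs n r) j) (λ π → trans (ΣL-cong (vecsOf (allSubs n r) s) (h π)) (ΣL-zero (vecsOf (allSubs n r) s))))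
          (ΣL-zero (vecsOf (allSubs n r) j))

  H≡stirlingSum : ∀ n j k → H r a j n k ≡ stirlingSum n j k
  H≡stirlingSum zero zero k = sym (trans (+-identityʳ _) (trans (ΣL-vecsOf-singleton [] s (λ S → ⟦stirling⟧ a k ([] , S))) (base k)))
    where
    base : ∀ k → ⟦stirling⟧ a k ([] , replicate s []) ≡ oneP k
    base zero = refl
    base (suc k) = refl
  H≡stirlingSum zero (suc j) k = sym (stirlingSum-vanishes 0 (suc j) k noBlocks)
    where
    noBlocks : ∀ (π : Vec (Sub 0 r) (suc j)) S → ⟦stirling⟧ a k (π , S) ≡ 0
    noBlocks ([] ∷ π) S = refl
  H≡stirlingSum (suc n) zero k = sym (stirlingSum-vanishes (suc n) 0 k noBlock1)
    where
    noBlock1 : ∀ (π : Vec (Sub (suc n) r) zero) S → ⟦stirling⟧ a k (π , S) ≡ 0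
    noBlock1 [] S rewrite ∧-zeroʳ (disjointCover ([] , S)) = refl
  H≡stirlingSum (suc n) (suc j) k =
    trans (cong₂ _+_ (H≡stirlingSum n j k)
      (trans (sumLe-convolution-comm k (qWeight j) (H r a (suc j) n))
             (sumLe-cong k (λ t → cong (_* qWeight j (k ∸ t)) (H≡stirlingSum n (suc j) t)))))
    (sym (stirlingSum-suc n j k))

propositionP : (r : ℕ) → 1 ≤ r → (a : Fin r → ℕ) → (∀ i i′ → i Fin.≤ i′ → a i ≤ a i′)
  → (n j k : ℕ) → H r a j n k ≡ stirlingCount r a n j k
propositionP (suc r') _ a mono n j k =
  trans (H≡stirlingSum n j k) (sym (stirlingCount≡stirlingSum n j k))
  where
  open Recurrence r' a (λ i → mono i (fromℕ r') (≤fromℕ i))
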